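{- If $m,n\ge 3$ are integers, then $\sigma_{(2,1)}(P_m\,\square\,P_n)=\left\lceil\frac{n+m+1}{2}\right\rceil$.
   Context: $P_k$ is the path on $k$ vertices and $\square$ is the Cartesian product of graphs ($(g,h)(g',h')$ is an edge iff $g=g'$ and $hh'$ is an edge, or $gg'$ is an edge and $h=h'$). Vertices are colored white or blue. Spreading color change rule with parameters $p\in\mathbb{N}$, $q\in\mathbb{N}\cup\{\infty\}$: if a white vertex $w$ has at least $p$ blue neighbors, and one of the blue neighbors of $w$ has at most $q$ white neighbors, then $w$ is recolored blue. A set $S$ is a $(p,q)$-spreading set if, when exactly the vertices of $S$ are initially blue, repeated application of this rule eventually makes all vertices blue; $\sigma_{(p,q)}(G)$ is the minimum size of a $(p,q)$-spreading set of $G$. -}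

module Defs where

open import Data.Bool using (Bool; true; false; _∧_; _∨_)
open import Data.Nat using (ℕ; _≤_; _≡ᵇ_; _*_; suc)
open import Data.Fin using (Fin; toℕ; remQuot)
open import Data.Fin.Subset using (Subset; _∈_; _∉_; _∩_; _∪_; ∁; ∣_∣; ⁅_⁆; ⊤)
open import Data.Vec using (tabulate)
open import Data.Product using (_×_; _,_; ∃; Σ-syntax)
open import Relation.Binary.PropositionalEquality using (_≡_)
open import Relation.Binary.Construct.Closure.ReflexiveTransitive using (Star)

record Graph : Set where
  field
    order : ℕ
    adj   : Fin order → Fin order → Bool
open Graph public

P : ℕ → Graph
P k = record { order = k
             ; adj = λ i j → (suc (toℕ i) ≡ᵇ toℕ j) ∨ (suc (toℕ j) ≡ᵇ toℕ i) }

-- Cartesian product G □ H, vertices Fin (|G| * |H|) identified with pairs via remQuot.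
_□_ : Graph → Graph → Graph
G □ H = record { order = order G * order H ; adj = a }
  where
  eqᵇ : ∀ {n} → Fin n → Fin n → Bool
  eqᵇ x y = toℕ x ≡ᵇ toℕ y
  a : Fin (order G * order H) → Fin (order G * order H) → Bool
  a u v with remQuot {order G} (order H) u | remQuot {order G} (order H) v
  ... | (g , h) | (g' , h') = (eqᵇ g g' ∧ adj H h h') ∨ (adj G g g' ∧ eqᵇ h h')

data ℕ∞ : Set where
  fin : ℕ → ℕ∞
  ∞   : ℕ∞

_≤∞_ : ℕ → ℕ∞ → Set
k ≤∞ fin q = k ≤ q
k ≤∞ ∞     = Data.Unit.⊤
  where import Data.Unit

module _ (G : Graph) where
  N : Fin (order G) → Subset (order G)
  N v = tabulate (adj G v)

  data Step (p : ℕ) (q : ℕ∞) (B : Subset (order G)) : Subset (order G) → Set where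
    step : (w : Fin (order G)) → w ∉ B →
           p ≤ ∣ N w ∩ B ∣ →
           (Σ[ u ∈ Fin (order G) ] (u ∈ N w × u ∈ B × ∣ N u ∩ ∁ B ∣ ≤∞ q)) →
           Step p q B (B ∪ ⁅ w ⁆)

  IsSpreadingSet : ℕ → ℕ∞ → Subset (order G) → Set
  IsSpreadingSet p q S = Star (Step p q) S ⊤

  σ≡ : ℕ → ℕ∞ → ℕ → Set
  σ≡ p q k = (Σ[ S ∈ Subset (order G) ] (IsSpreadingSet p q S × ∣ S ∣ ≡ k))
           × ((S : Subset (order G)) → IsSpreadingSet p q S → k ≤ ∣ S ∣)

module Submission where

-- Let Φ B be twice the number of edges inside the blue set B.  A step recolours a
-- vertex with at least two blue neighbours, so it raises ∣ B ∣ by one and Φ by at least 4.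
-- Before the first step of a spreading set S ≠ ⊤ we already have Φ S ≥ 2: the forcing vertex u has
-- at most one white neighbour, namely the vertex it forces, so a second neighbour of u is blue.
-- Since Φ ⊤ is the degree sum, at most 4mn − 2(m + n), comparing S with ⊤ gives 4∣S∣ ≥ 2(m + n + 1).
--
-- Seed the corners (0,0), (0,n−1), (m−1,0) and alternate cells of the first row and
-- of the first column, with opposite phases.  Then the anti-diagonals fill one after another, each
-- cell by cell from the top (or, after transposing, from the left), every cell being forced by its
-- neighbour on the previous anti-diagonal.  Choosing the phase by the parity of n leaves at most
-- ⌈(n + m + 1)/2⌉ seeds, and every superset of a seed set spreads as well.

open import Defs
open import Data.Bool using (Bool; true; false; _∧_; _∨_; not; T)
import Data.Bool.Properties as Boolₚ
open import Data.Empty using (⊥-elim)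
open import Data.Fin as Fin using (Fin; toℕ; fromℕ<; combine; remQuot; _↑ˡ_; _↑ʳ_)
import Data.Fin.Properties as Finₚ
open import Data.Fin.Subset using (Subset; _∉_; _∩_; _∪_; ∁; ∣_∣; ⁅_⁆; ⊤; ⊥)
import Data.Fin.Subset.Properties as Subsetₚ
open import Data.List using (List; []; _∷_; _++_; length; map)
import Data.List.Properties as Listₚ
open import Data.List.Membership.Propositional using (_∈_)
open import Data.List.Membership.Propositional.Properties using (∈-map⁺; ∈-++⁺ˡ; ∈-++⁺ʳ)
open import Data.List.Relation.Unary.Any using (here; there)
open import Data.Nat using (ℕ; zero; suc; _+_; _*_; _≤_; _<_; _≥_; z≤n; s≤s; s≤s⁻¹; _≡ᵇ_; _<ᵇ_; parity; ⌊_/2⌋; ⌈_/2⌉)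
open import Data.Nat.Properties
open import Algebra.Properties.Semiring.Sum +-*-semiring using (sum; sum-cong-≗; ∑-distrib-+; *-distribˡ-sum)
open import Data.Nat.Tactic.RingSolver using (solve-∀)
open import Data.Parity.Base using (Parity; 0ℙ; 1ℙ; _⁻¹)
import Data.Parity.Properties as Parityₚ
open import Data.Product using (Σ-syntax; _×_; _,_; proj₁; proj₂)
open import Data.Sum using (_⊎_; inj₁; inj₂)
open import Data.Vec using (Vec; []; _∷_; lookup; tabulate)
import Data.Vec.Properties as Vecₚ
open import Function using (_∘_)
open import Relation.Binary using (tri<; tri≈; tri>)
open import Relation.Binary.Construct.Closure.ReflexiveTransitive using (Star; ε; _◅_; _◅◅_)
open import Relation.Binary.PropositionalEquality
open import Relation.Nullary using (¬_; yes; no)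

-- Finite sums and subsets

𝟙 : Bool → ℕ
𝟙 true = 1
𝟙 false = 0

𝟙≤1 : ∀ b → 𝟙 b ≤ 1
𝟙≤1 true = ≤-refl
𝟙≤1 false = z≤n

𝟙-∧ : ∀ a b → 𝟙 (a ∧ b) ≡ 𝟙 a * 𝟙 b
𝟙-∧ true b = sym (+-identityʳ _)
𝟙-∧ false b = refl

𝟙-∨ : ∀ a b → 𝟙 (a ∨ b) ≤ 𝟙 a + 𝟙 b
𝟙-∨ true b = s≤s z≤n
𝟙-∨ false b = ≤-refl

sum-mono-≤ : ∀ {n} {f g : Fin n → ℕ} → (∀ i → f i ≤ g i) → sum f ≤ sum g
sum-mono-≤ {zero} f≤g = z≤n
sum-mono-≤ {suc n} f≤g = +-mono-≤ (f≤g Fin.zero) (sum-mono-≤ (f≤g ∘ Fin.suc))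

sum-const : ∀ {n} c → sum {n} (λ _ → c) ≡ n * c
sum-const {zero} c = refl
sum-const {suc n} c = cong (c +_) (sum-const {n} c)

sum-zero : ∀ {n} {f : Fin n → ℕ} → (∀ i → f i ≡ 0) → sum f ≡ 0
sum-zero {n} f≡0 = trans (sum-cong-≗ f≡0) (trans (sum-const {n} 0) (*-zeroʳ n))

term≤sum : ∀ {n} (f : Fin n → ℕ) i → f i ≤ sum f
term≤sum f Fin.zero = m≤m+n _ _
term≤sum f (Fin.suc i) = ≤-trans (term≤sum (f ∘ Fin.suc) i) (m≤n+m _ _)

sum-single : ∀ {n} (f : Fin n → ℕ) i → (∀ j → j ≢ i → f j ≡ 0) → sum f ≡ f i
sum-single f Fin.zero f≡0 = trans (cong (f Fin.zero +_) (sum-zero (λ j → f≡0 (Fin.suc j) λ ()))) (+-identityʳ _)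
sum-single f (Fin.suc i) f≡0 rewrite f≡0 Fin.zero (λ ()) =
  sum-single (f ∘ Fin.suc) i (λ j j≢i → f≡0 (Fin.suc j) (j≢i ∘ Finₚ.suc-injective))

2≤sum : ∀ {n} (f : Fin n → ℕ) {i j} → i ≢ j → 1 ≤ f i → 1 ≤ f j → 2 ≤ sum f
2≤sum f {Fin.zero} {Fin.zero} i≢j _ _ = ⊥-elim (i≢j refl)
2≤sum f {Fin.zero} {Fin.suc j} _ fi fj = +-mono-≤ fi (≤-trans fj (term≤sum (f ∘ Fin.suc) j))
2≤sum f {Fin.suc i} {Fin.zero} _ fi fj = +-mono-≤ fj (≤-trans fi (term≤sum (f ∘ Fin.suc) i))
2≤sum f {Fin.suc i} {Fin.suc j} i≢j fi fj =
  ≤-trans (2≤sum (f ∘ Fin.suc) (i≢j ∘ cong Fin.suc) fi fj) (m≤n+m _ _)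

sum≤1 : ∀ {n} (f : Fin n → ℕ) → (∀ i → f i ≤ 1) → (∀ i j → 1 ≤ f i → 1 ≤ f j → i ≡ j) → sum f ≤ 1
sum≤1 {zero} f _ _ = z≤n
sum≤1 {suc n} f f≤1 unique with f Fin.zero in f₀≡
... | zero = sum≤1 (f ∘ Fin.suc) (f≤1 ∘ Fin.suc) (λ i j fi fj → Finₚ.suc-injective (unique _ _ fi fj))
... | suc k = begin
  suc k + sum (f ∘ Fin.suc) ≡⟨ cong (suc k +_) (sum-zero rest≡0) ⟩
  suc k + 0                ≡⟨ +-identityʳ (suc k) ⟩
  suc k                    ≡⟨ f₀≡ ⟨
  f Fin.zero               ≤⟨ f≤1 Fin.zero ⟩
  1                        ∎
  where
  open ≤-Reasoning
  rest≡0 : ∀ i → f (Fin.suc i) ≡ 0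
  rest≡0 i with f (Fin.suc i) in fi≡
  ... | zero = refl
  ... | suc _ with unique Fin.zero (Fin.suc i) (≤-trans (s≤s z≤n) (≤-reflexive (sym f₀≡)))
                                                (≤-trans (s≤s z≤n) (≤-reflexive (sym fi≡)))
  ...   | ()

sum-↑ : ∀ m {n} (f : Fin (m + n) → ℕ) → sum f ≡ sum (λ i → f (i ↑ˡ n)) + sum (λ j → f (m ↑ʳ j))
sum-↑ zero f = refl
sum-↑ (suc m) f = trans (cong (f Fin.zero +_) (sum-↑ m (f ∘ Fin.suc))) (sym (+-assoc (f Fin.zero) _ _))

sum-combine : ∀ m {n} (f : Fin (m * n) → ℕ) → sum f ≡ sum {m} (λ i → sum {n} (λ j → f (combine i j)))
sum-combine zero f = refl
sum-combine (suc m) {n} f = trans (sum-↑ n f) (cong (sum (λ j → f (j ↑ˡ (m * n))) +_) (sum-combine m (λ v → f (n ↑ʳ v))))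

∣p∣≡sum : ∀ {n} (p : Subset n) → ∣ p ∣ ≡ sum (𝟙 ∘ lookup p)
∣p∣≡sum [] = refl
∣p∣≡sum (true ∷ p) = cong suc (∣p∣≡sum p)
∣p∣≡sum (false ∷ p) = ∣p∣≡sum p

lookup-∩ : ∀ {n} (p q : Subset n) i → lookup (p ∩ q) i ≡ lookup p i ∧ lookup q i
lookup-∩ p q i = Vecₚ.lookup-zipWith _∧_ i p q

lookup-∪ : ∀ {n} (p q : Subset n) i → lookup (p ∪ q) i ≡ lookup p i ∨ lookup q i
lookup-∪ p q i = Vecₚ.lookup-zipWith _∨_ i p q

lookup-∁ : ∀ {n} (p : Subset n) i → lookup (∁ p) i ≡ not (lookup p i)
lookup-∁ p i = Vecₚ.lookup-map i not p

lookup-⊤ : ∀ {n} (i : Fin n) → lookup ⊤ i ≡ true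
lookup-⊤ i = Vecₚ.lookup-replicate i true

lookup-⁅i⁆-i : ∀ {n} (i : Fin n) → lookup ⁅ i ⁆ i ≡ true
lookup-⁅i⁆-i i = Vecₚ.[]=⇒lookup (Subsetₚ.x∈⁅x⁆ i)

lookup-⁅i⁆-j : ∀ {n} {i j : Fin n} → j ≢ i → lookup ⁅ i ⁆ j ≡ false
lookup-⁅i⁆-j {i = i} {j} j≢i with lookup ⁅ i ⁆ j in j∈⁅i⁆
... | true = ⊥-elim (Subsetₚ.x≢y⇒x∉⁅y⁆ j≢i (Vecₚ.lookup⇒[]= j ⁅ i ⁆ j∈⁅i⁆))
... | false = refl

≗⇒≡ : ∀ {n} {A : Set} {xs ys : Vec A n} → (∀ i → lookup xs i ≡ lookup ys i) → xs ≡ ys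
≗⇒≡ {xs = xs} {ys} eq = trans (sym (Vecₚ.tabulate∘lookup xs)) (trans (Vecₚ.tabulate-cong eq) (Vecₚ.tabulate∘lookup ys))

∣p∪q∣≤∣p∣+∣q∣ : ∀ {n} (p q : Subset n) → ∣ p ∪ q ∣ ≤ ∣ p ∣ + ∣ q ∣
∣p∪q∣≤∣p∣+∣q∣ p q = begin
  ∣ p ∪ q ∣                                    ≡⟨ ∣p∣≡sum (p ∪ q) ⟩
  sum (𝟙 ∘ lookup (p ∪ q))                     ≤⟨ sum-mono-≤ 𝟙-lookup-∪ ⟩
  sum (λ i → 𝟙 (lookup p i) + 𝟙 (lookup q i)) ≡⟨ ∑-distrib-+ (𝟙 ∘ lookup p) (𝟙 ∘ lookup q) ⟩
  sum (𝟙 ∘ lookup p) + sum (𝟙 ∘ lookup q)      ≡⟨ cong₂ _+_ (∣p∣≡sum p) (∣p∣≡sum q) ⟨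
  ∣ p ∣ + ∣ q ∣                                ∎
  where
  open ≤-Reasoning
  𝟙-lookup-∪ : ∀ i → 𝟙 (lookup (p ∪ q) i) ≤ 𝟙 (lookup p i) + 𝟙 (lookup q i)
  𝟙-lookup-∪ i rewrite lookup-∪ p q i = 𝟙-∨ (lookup p i) (lookup q i)

module _ {n} (p : Subset n) {i : Fin n} (i∉p : lookup p i ≡ false) where

  𝟙-∪⁅i⁆ : ∀ j → 𝟙 (lookup (p ∪ ⁅ i ⁆) j) ≡ 𝟙 (lookup p j) + 𝟙 (lookup ⁅ i ⁆ j)
  𝟙-∪⁅i⁆ j rewrite lookup-∪ p ⁅ i ⁆ j with j Finₚ.≟ i
  ... | yes refl rewrite i∉p | lookup-⁅i⁆-i i = refl
  ... | no j≢i rewrite lookup-⁅i⁆-j j≢i with lookup p j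
  ...   | true = refl
  ...   | false = refl

  ∣p∪⁅i⁆∣≡1+∣p∣ : ∣ p ∪ ⁅ i ⁆ ∣ ≡ suc ∣ p ∣
  ∣p∪⁅i⁆∣≡1+∣p∣ = begin
    ∣ p ∪ ⁅ i ⁆ ∣                                ≡⟨ ∣p∣≡sum (p ∪ ⁅ i ⁆) ⟩
    sum (𝟙 ∘ lookup (p ∪ ⁅ i ⁆))                 ≡⟨ sum-cong-≗ 𝟙-∪⁅i⁆ ⟩
    sum (λ j → 𝟙 (lookup p j) + 𝟙 (lookup ⁅ i ⁆ j)) ≡⟨ ∑-distrib-+ (𝟙 ∘ lookup p) (𝟙 ∘ lookup ⁅ i ⁆) ⟩
    sum (𝟙 ∘ lookup p) + sum (𝟙 ∘ lookup ⁅ i ⁆)  ≡⟨ cong₂ _+_ (∣p∣≡sum p) (∣p∣≡sum ⁅ i ⁆) ⟨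
    ∣ p ∣ + ∣ ⁅ i ⁆ ∣                            ≡⟨ cong (∣ p ∣ +_) (Subsetₚ.∣⁅x⁆∣≡1 i) ⟩
    ∣ p ∣ + 1                                    ≡⟨ +-comm ∣ p ∣ 1 ⟩
    suc ∣ p ∣                                    ∎
    where open ≡-Reasoning

p∪⁅i⁆≡p : ∀ {n} (p : Subset n) {i} → lookup p i ≡ true → p ∪ ⁅ i ⁆ ≡ p
p∪⁅i⁆≡p p {i} i∈p = ≗⇒≡ λ j → trans (lookup-∪ p ⁅ i ⁆ j) (absorb j)
  where
  absorb : ∀ j → lookup p j ∨ lookup ⁅ i ⁆ j ≡ lookup p j
  absorb j with j Finₚ.≟ i
  ... | yes refl rewrite i∈p = refl
  ... | no j≢i rewrite lookup-⁅i⁆-j j≢i = Boolₚ.∨-identityʳ _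

⊇-of-size : ∀ {n} (p : Subset n) k → ∣ p ∣ ≤ k → k ≤ n →
            Σ[ q ∈ Subset n ] (∀ i → lookup p i ≡ true → lookup q i ≡ true) × ∣ q ∣ ≡ k
⊇-of-size [] zero _ _ = [] , (λ ()) , refl
⊇-of-size (true ∷ p) (suc k) (s≤s ∣p∣≤k) (s≤s k≤n) with ⊇-of-size p k ∣p∣≤k k≤n
... | q , p⊆q , ∣q∣≡k = true ∷ q , (λ { Fin.zero _ → refl ; (Fin.suc i) → p⊆q i }) , cong suc ∣q∣≡k
⊇-of-size {suc n} (false ∷ p) k ∣p∣≤k k≤1+n with k ≤? n
... | yes k≤n with ⊇-of-size p k ∣p∣≤k k≤n
...   | q , p⊆q , ∣q∣≡k = false ∷ q , (λ { Fin.zero () ; (Fin.suc i) → p⊆q i }) , ∣q∣≡k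
⊇-of-size {suc n} (false ∷ p) k ∣p∣≤k k≤1+n | no k≰n =
  ⊤ , (λ i _ → lookup-⊤ i) , trans (Subsetₚ.∣⊤∣≡n (suc n)) (≤-antisym (≰⇒> k≰n) k≤1+n)

true≢false : true ≢ false
true≢false ()

-- Spreading on a symmetric graph

Symmetric : Graph → Set
Symmetric G = ∀ u v → adj G u v ≡ adj G v u

-- Minimum degree at least 2, phrased without counting.
MinDegree≥2 : Graph → Set
MinDegree≥2 G = ∀ u w → Σ[ x ∈ Fin (order G) ] adj G u x ≡ true × x ≢ w × x ≢ u

module Spreading (G : Graph) (adj-sym : Symmetric G) where

  V : Set
  V = Fin (order G)

  A : V → V → Bool
  A = adj G

  SpreadStep : Subset (order G) → Subset (order G) → Set
  SpreadStep = Step G 2 (fin 1)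

  lookup-N : ∀ w x → lookup (N G w) x ≡ A w x
  lookup-N w x = Vecₚ.lookup∘tabulate (A w) x

  blueDegree : Subset (order G) → V → ℕ
  blueDegree B v = sum (λ x → 𝟙 (A v x ∧ lookup B x))

  ∣N∩B∣≡blueDegree : ∀ B w → ∣ N G w ∩ B ∣ ≡ blueDegree B w
  ∣N∩B∣≡blueDegree B w = trans (∣p∣≡sum (N G w ∩ B))
    (sum-cong-≗ λ x → cong 𝟙 (trans (lookup-∩ (N G w) B x) (cong (_∧ lookup B x) (lookup-N w x))))

  -- Twice the number of edges inside B.
  Φ : Subset (order G) → ℕ
  Φ B = sum (λ v → 𝟙 (lookup B v) * blueDegree B v)

  module _ (B : Subset (order G)) {w : V} (w∉B : lookup B w ≡ false) where

    private
      𝟙w : V → ℕ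
      𝟙w v = 𝟙 (lookup ⁅ w ⁆ v)

    sum-𝟙w* : ∀ (g : V → ℕ) → sum (λ v → 𝟙w v * g v) ≡ g w
    sum-𝟙w* g = trans (sum-single _ w (λ v v≢w → cong (λ b → 𝟙 b * g v) (lookup-⁅i⁆-j v≢w)))
                      (trans (cong (λ b → 𝟙 b * g w) (lookup-⁅i⁆-i w)) (+-identityʳ (g w)))

    blueDegree-∪⁅w⁆ : ∀ v → blueDegree (B ∪ ⁅ w ⁆) v ≡ blueDegree B v + 𝟙 (A v w)
    blueDegree-∪⁅w⁆ v = begin
      sum (λ x → 𝟙 (A v x ∧ lookup (B ∪ ⁅ w ⁆) x))
        ≡⟨ sum-cong-≗ split ⟩
      sum (λ x → 𝟙 (A v x ∧ lookup B x) + 𝟙w x * 𝟙 (A v x))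
        ≡⟨ ∑-distrib-+ (λ x → 𝟙 (A v x ∧ lookup B x)) (λ x → 𝟙w x * 𝟙 (A v x)) ⟩
      blueDegree B v + sum (λ x → 𝟙w x * 𝟙 (A v x))
        ≡⟨ cong (blueDegree B v +_) (sum-𝟙w* (𝟙 ∘ A v)) ⟩
      blueDegree B v + 𝟙 (A v w) ∎
      where
      open ≡-Reasoning
      split : ∀ x → 𝟙 (A v x ∧ lookup (B ∪ ⁅ w ⁆) x) ≡ 𝟙 (A v x ∧ lookup B x) + 𝟙w x * 𝟙 (A v x)
      split x rewrite 𝟙-∧ (A v x) (lookup (B ∪ ⁅ w ⁆) x) | 𝟙-∧ (A v x) (lookup B x) | 𝟙-∪⁅i⁆ B w∉B x =
        trans (*-distribˡ-+ (𝟙 (A v x)) _ _) (cong (𝟙 (A v x) * 𝟙 (lookup B x) +_) (*-comm (𝟙 (A v x)) _))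

    Φ-∪⁅w⁆ : Φ B + 2 * blueDegree B w ≤ Φ (B ∪ ⁅ w ⁆)
    Φ-∪⁅w⁆ = begin
      Φ B + 2 * blueDegree B w
        ≡⟨ cong (Φ B +_) (cong₂ (λ x y → x + (y + 0)) (sym edges-to-w) (sym (sum-𝟙w* (blueDegree B)))) ⟩
      Φ B + (sum (λ v → b v * a v) + (sum (λ v → 𝟙w v * d v) + 0))
        ≡⟨ cong (λ t → Φ B + (sum (λ v → b v * a v) + t)) (+-identityʳ _) ⟩
      Φ B + (sum (λ v → b v * a v) + sum (λ v → 𝟙w v * d v))
        ≡⟨ sym (trans (∑-distrib-+ (λ v → b v * d v) _) (cong (Φ B +_) (∑-distrib-+ (λ v → b v * a v) _))) ⟩
      sum (λ v → b v * d v + (b v * a v + 𝟙w v * d v))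
        ≤⟨ sum-mono-≤ (λ v → expand (b v) (𝟙w v) (d v) (a v)) ⟩
      sum (λ v → (b v + 𝟙w v) * (d v + a v))
        ≡⟨ sum-cong-≗ (λ v → sym (cong₂ _*_ (𝟙-∪⁅i⁆ B w∉B v) (blueDegree-∪⁅w⁆ v))) ⟩
      Φ (B ∪ ⁅ w ⁆) ∎
      where
      open ≤-Reasoning
      b d a : V → ℕ
      b v = 𝟙 (lookup B v)
      d v = blueDegree B v
      a v = 𝟙 (A v w)
      edges-to-w : sum (λ v → b v * a v) ≡ blueDegree B w
      edges-to-w = sum-cong-≗ λ v → trans (sym (𝟙-∧ (lookup B v) (A v w)))
        (cong 𝟙 (trans (Boolₚ.∧-comm (lookup B v) (A v w)) (cong (_∧ lookup B v) (adj-sym v w))))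
      expand : ∀ b c d a → b * d + (b * a + c * d) ≤ (b + c) * (d + a)
      expand b c d a = subst (b * d + (b * a + c * d) ≤_) (ring b c d a) (m≤m+n _ (c * a))
        where
        ring : ∀ b c d a → b * d + (b * a + c * d) + c * a ≡ (b + c) * (d + a)
        ring = solve-∀

  ∉⇒lookup≡false : ∀ {B : Subset (order G)} {w} → w ∉ B → lookup B w ≡ false
  ∉⇒lookup≡false {B} {w} w∉B with lookup B w in w∈B
  ... | true = ⊥-elim (w∉B (Vecₚ.lookup⇒[]= w B w∈B))
  ... | false = refl

  SpreadStep⇒growth : ∀ {B B'} → SpreadStep B B' → ∣ B' ∣ ≡ suc ∣ B ∣ × Φ B + 4 ≤ Φ B'
  SpreadStep⇒growth {B} (step w w∉B 2≤∣N∩B∣ _) =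
    ∣p∪⁅i⁆∣≡1+∣p∣ B w∉B′ , ≤-trans (+-monoʳ-≤ (Φ B) (*-monoʳ-≤ 2 2≤deg)) (Φ-∪⁅w⁆ B w∉B′)
    where
    w∉B′ : lookup B w ≡ false
    w∉B′ = ∉⇒lookup≡false w∉B
    2≤deg : 2 ≤ blueDegree B w
    2≤deg = subst (2 ≤_) (∣N∩B∣≡blueDegree B w) 2≤∣N∩B∣

  spreading-invariant : ∀ {S B} → Star SpreadStep S B → Φ S + 4 * ∣ B ∣ ≤ Φ B + 4 * ∣ S ∣
  spreading-invariant ε = ≤-refl
  spreading-invariant {S} {B} (_◅_ {j = Y} S→Y Y→*B) with SpreadStep⇒growth S→Y
  ... | ∣Y∣≡1+∣S∣ , ΦS+4≤ΦY = +-cancelʳ-≤ 4 _ _ (begin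
    Φ S + 4 * ∣ B ∣ + 4   ≡⟨ +-*-arrange (Φ S) (4 * ∣ B ∣) ⟩
    Φ S + 4 + 4 * ∣ B ∣   ≤⟨ +-monoˡ-≤ (4 * ∣ B ∣) ΦS+4≤ΦY ⟩
    Φ Y + 4 * ∣ B ∣       ≤⟨ spreading-invariant Y→*B ⟩
    Φ B + 4 * ∣ Y ∣       ≡⟨ cong (λ y → Φ B + 4 * y) ∣Y∣≡1+∣S∣ ⟩
    Φ B + 4 * suc ∣ S ∣   ≡⟨ +-*-suc (Φ B) ∣ S ∣ ⟩
    Φ B + 4 * ∣ S ∣ + 4   ∎)
    where
    open ≤-Reasoning
    +-*-arrange : ∀ a b → a + b + 4 ≡ a + 4 + b
    +-*-arrange = solve-∀
    +-*-suc : ∀ a b → a + 4 * suc b ≡ a + 4 * b + 4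
    +-*-suc = solve-∀

  -- Before any step, the blue vertex u that forces is adjacent to a second blue vertex.
  2≤Φ-before-step : MinDegree≥2 G → ∀ {S Y} → SpreadStep S Y → 2 ≤ Φ S
  2≤Φ-before-step min2 {S} (step w w∉S _ (u , u∈Nw , u∈S , ∣Nu∩∁S∣≤1))
    with min2 u w
  ... | x , Aux , x≢w , x≢u =
    2≤sum _ (x≢u ∘ sym) (1≤Φ-term u∈S′ x∈S Aux) (1≤Φ-term x∈S u∈S′ (trans (adj-sym x u) Aux))
    where
    u∈S′ : lookup S u ≡ true
    u∈S′ = Vecₚ.[]=⇒lookup u∈S
    Auw : A u w ≡ true
    Auw = trans (adj-sym u w) (trans (sym (lookup-N w u)) (Vecₚ.[]=⇒lookup u∈Nw))
    1≤𝟙-white : ∀ z → A u z ≡ true → lookup S z ≡ false → 1 ≤ 𝟙 (lookup (N G u ∩ ∁ S) z)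
    1≤𝟙-white z Auz z∉S rewrite lookup-∩ (N G u) (∁ S) z | lookup-N u z | lookup-∁ S z | Auz | z∉S = ≤-refl
    x∈S : lookup S x ≡ true
    x∈S with lookup S x in x∉S
    ... | true = refl
    ... | false = ⊥-elim (2≰1 (begin
      2                                ≤⟨ 2≤sum _ x≢w (1≤𝟙-white x Aux x∉S) (1≤𝟙-white w Auw (∉⇒lookup≡false w∉S)) ⟩
      sum (𝟙 ∘ lookup (N G u ∩ ∁ S))   ≡⟨ ∣p∣≡sum (N G u ∩ ∁ S) ⟨
      ∣ N G u ∩ ∁ S ∣                  ≤⟨ ∣Nu∩∁S∣≤1 ⟩
      1                                ∎))
      where
      open ≤-Reasoning
      2≰1 : ¬ 2 ≤ 1
      2≰1 (s≤s ())
    1≤Φ-term : ∀ {a b} → lookup S a ≡ true → lookup S b ≡ true → A a b ≡ true →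
               1 ≤ 𝟙 (lookup S a) * blueDegree S a
    1≤Φ-term {a} {b} a∈S b∈S Aab rewrite a∈S | +-identityʳ (blueDegree S a) =
      ≤-trans (≤-reflexive (cong 𝟙 (sym (cong₂ _∧_ Aab b∈S)))) (term≤sum (λ z → 𝟙 (A a z ∧ lookup S z)) b)

  spreading-lower-bound : MinDegree≥2 G → ∀ S → IsSpreadingSet G 2 (fin 1) S →
                          S ≡ ⊤ ⊎ 2 + 4 * order G ≤ Φ ⊤ + 4 * ∣ S ∣
  spreading-lower-bound min2 S ε = inj₁ refl
  spreading-lower-bound min2 S S→*⊤@(S→Y ◅ _) = inj₂ (begin
    2 + 4 * order G      ≤⟨ +-monoˡ-≤ _ (2≤Φ-before-step min2 S→Y) ⟩
    Φ S + 4 * order G    ≡⟨ cong (λ k → Φ S + 4 * k) (Subsetₚ.∣⊤∣≡n (order G)) ⟨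
    Φ S + 4 * ∣ ⊤ {order G} ∣ ≤⟨ spreading-invariant S→*⊤ ⟩
    Φ ⊤ + 4 * ∣ S ∣      ∎)
    where open ≤-Reasoning

  record Forcing (B : Subset (order G)) (w : V) : Set where
    field
      x y : V
      x≢y : x ≢ y
      w~x : A w x ≡ true
      w~y : A w y ≡ true
      x∈B : lookup B x ≡ true
      y∈B : lookup B y ≡ true
      x-surrounded : ∀ z → A x z ≡ true → z ≢ w → lookup B z ≡ true

  Forcing⇒SpreadStep : ∀ {B w} → lookup B w ≡ false → Forcing B w → SpreadStep B (B ∪ ⁅ w ⁆)
  Forcing⇒SpreadStep {B} {w} w∉B f =
    step w (λ w∈B → true≢false (trans (sym (Vecₚ.[]=⇒lookup w∈B)) w∉B))
      (subst (2 ≤_) (sym (∣N∩B∣≡blueDegree B w)) (2≤sum _ x≢y (1≤𝟙-blue w~x x∈B) (1≤𝟙-blue w~y y∈B)))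
      (x , Vecₚ.lookup⇒[]= x (N G w) (trans (lookup-N w x) w~x) , Vecₚ.lookup⇒[]= x B x∈B , ∣Nx∩∁B∣≤1)
    where
    open Forcing f
    1≤𝟙-blue : ∀ {z} → A w z ≡ true → lookup B z ≡ true → 1 ≤ 𝟙 (A w z ∧ lookup B z)
    1≤𝟙-blue w~z z∈B rewrite w~z | z∈B = ≤-refl
    only-w-white : ∀ z → z ≢ w → 𝟙 (lookup (N G x ∩ ∁ B) z) ≡ 0
    only-w-white z z≢w rewrite lookup-∩ (N G x) (∁ B) z | lookup-N x z | lookup-∁ B z with A x z in x~z
    ... | false = refl
    ... | true rewrite x-surrounded z x~z z≢w = refl
    ∣Nx∩∁B∣≤1 : ∣ N G x ∩ ∁ B ∣ ≤ 1
    ∣Nx∩∁B∣≤1 = begin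
      ∣ N G x ∩ ∁ B ∣                ≡⟨ ∣p∣≡sum (N G x ∩ ∁ B) ⟩
      sum (𝟙 ∘ lookup (N G x ∩ ∁ B)) ≡⟨ sum-single _ w only-w-white ⟩
      𝟙 (lookup (N G x ∩ ∁ B) w)    ≤⟨ 𝟙≤1 _ ⟩
      1                              ∎
      where open ≤-Reasoning

  spread-to : ∀ {S B} w → Star SpreadStep S B → (lookup B w ≡ false → Forcing B w) →
              Star SpreadStep S (B ∪ ⁅ w ⁆)
  spread-to {S} {B} w S→*B forcing with lookup B w in w∈B
  ... | true = subst (Star SpreadStep S) (sym (p∪⁅i⁆≡p B w∈B)) S→*B
  ... | false = S→*B ◅◅ (Forcing⇒SpreadStep w∈B (forcing refl) ◅ ε)

-- Grid coordinates

≡ᵇ≡true⇒≡ : ∀ a b → (a ≡ᵇ b) ≡ true → a ≡ b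
≡ᵇ≡true⇒≡ zero zero _ = refl
≡ᵇ≡true⇒≡ (suc a) (suc b) eq = cong suc (≡ᵇ≡true⇒≡ a b eq)

≡⇒≡ᵇ≡true : ∀ a b → a ≡ b → (a ≡ᵇ b) ≡ true
≡⇒≡ᵇ≡true zero zero _ = refl
≡⇒≡ᵇ≡true (suc a) (suc b) eq = ≡⇒≡ᵇ≡true a b (suc-injective eq)

≢⇒≡ᵇ≡false : ∀ a b → a ≢ b → (a ≡ᵇ b) ≡ false
≢⇒≡ᵇ≡false a b a≢b with a ≡ᵇ b in eq
... | true = ⊥-elim (a≢b (≡ᵇ≡true⇒≡ a b eq))
... | false = refl

≡ᵇ-sym : ∀ a b → (a ≡ᵇ b) ≡ (b ≡ᵇ a)
≡ᵇ-sym zero zero = refl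
≡ᵇ-sym zero (suc b) = refl
≡ᵇ-sym (suc a) zero = refl
≡ᵇ-sym (suc a) (suc b) = ≡ᵇ-sym a b

<⇒<ᵇ≡true : ∀ {a b} → a < b → (a <ᵇ b) ≡ true
<⇒<ᵇ≡true {a} {b} a<b with a <ᵇ b | <⇒<ᵇ a<b
... | true | _ = refl

≮⇒<ᵇ≡false : ∀ {a b} → ¬ a < b → (a <ᵇ b) ≡ false
≮⇒<ᵇ≡false {a} {b} a≮b with a <ᵇ b in eq
... | true = ⊥-elim (a≮b (<ᵇ⇒< a b (subst T (sym eq) _)))
... | false = refl

data GridAdjacent (a b c d : ℕ) : Set where
  right : a ≡ c → suc b ≡ d → GridAdjacent a b c d
  left  : a ≡ c → suc d ≡ b → GridAdjacent a b c d
  down  : suc a ≡ c → b ≡ d → GridAdjacent a b c d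
  up    : suc c ≡ a → b ≡ d → GridAdjacent a b c d

transpose-adjacent : ∀ {a b c d} → GridAdjacent a b c d → GridAdjacent b a d c
transpose-adjacent (right p q) = down q p
transpose-adjacent (left p q) = up q p
transpose-adjacent (down p q) = right q p
transpose-adjacent (up p q) = left q p

GridAdjacent-irrefl : ∀ {a b} → ¬ GridAdjacent a b a b
GridAdjacent-irrefl (right _ eq) = 1+n≢n eq
GridAdjacent-irrefl (left _ eq) = 1+n≢n eq
GridAdjacent-irrefl (down eq _) = 1+n≢n eq
GridAdjacent-irrefl (up eq _) = 1+n≢n eq

gridAdjacentᵇ : ℕ → ℕ → ℕ → ℕ → Bool
gridAdjacentᵇ a b c d = ((a ≡ᵇ c) ∧ ((suc b ≡ᵇ d) ∨ (suc d ≡ᵇ b))) ∨ (((suc a ≡ᵇ c) ∨ (suc c ≡ᵇ a)) ∧ (b ≡ᵇ d))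

gridAdjacentᵇ-sym : ∀ a b c d → gridAdjacentᵇ a b c d ≡ gridAdjacentᵇ c d a b
gridAdjacentᵇ-sym a b c d rewrite ≡ᵇ-sym a c | ≡ᵇ-sym b d
  | Boolₚ.∨-comm (suc b ≡ᵇ d) (suc d ≡ᵇ b) | Boolₚ.∨-comm (suc a ≡ᵇ c) (suc c ≡ᵇ a) = refl

gridAdjacentᵇ-sound : ∀ a b c d → gridAdjacentᵇ a b c d ≡ true → GridAdjacent a b c d
gridAdjacentᵇ-sound a b c d eq with a ≡ᵇ c in a≡c | suc b ≡ᵇ d in b<d | suc d ≡ᵇ b in d<b
                                  | suc a ≡ᵇ c in a<c | suc c ≡ᵇ a in c<a | b ≡ᵇ d in b≡d
... | true | true | _ | _ | _ | _ = right (≡ᵇ≡true⇒≡ a c a≡c) (≡ᵇ≡true⇒≡ (suc b) d b<d)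
... | true | false | true | _ | _ | _ = left (≡ᵇ≡true⇒≡ a c a≡c) (≡ᵇ≡true⇒≡ (suc d) b d<b)
... | _ | _ | _ | true | _ | true = down (≡ᵇ≡true⇒≡ (suc a) c a<c) (≡ᵇ≡true⇒≡ b d b≡d)
... | _ | _ | _ | false | true | true = up (≡ᵇ≡true⇒≡ (suc c) a c<a) (≡ᵇ≡true⇒≡ b d b≡d)

gridAdjacentᵇ-complete : ∀ a b c d → GridAdjacent a b c d → gridAdjacentᵇ a b c d ≡ true
gridAdjacentᵇ-complete a b c d (right refl refl)
  rewrite ≡⇒≡ᵇ≡true a a refl | ≡⇒≡ᵇ≡true b b refl = refl
gridAdjacentᵇ-complete a b c d (left refl refl)
  rewrite ≡⇒≡ᵇ≡true a a refl | ≡⇒≡ᵇ≡true d d refl | Boolₚ.∨-zeroʳ (suc (suc d) ≡ᵇ d) = refl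
gridAdjacentᵇ-complete a b c d (down refl refl)
  rewrite ≡⇒≡ᵇ≡true a a refl | ≡⇒≡ᵇ≡true b b refl = Boolₚ.∨-zeroʳ _
gridAdjacentᵇ-complete a b c d (up refl refl)
  rewrite ≡⇒≡ᵇ≡true c c refl | ≡⇒≡ᵇ≡true b b refl | Boolₚ.∨-zeroʳ (suc (suc c) ≡ᵇ c) = Boolₚ.∨-zeroʳ _

𝟙-gridAdjacentᵇ : ∀ a b c d → 𝟙 (gridAdjacentᵇ a b c d) ≤
  𝟙 ((a ≡ᵇ c) ∧ (suc b ≡ᵇ d)) + 𝟙 ((a ≡ᵇ c) ∧ (suc d ≡ᵇ b)) +
  (𝟙 ((suc a ≡ᵇ c) ∧ (b ≡ᵇ d)) + 𝟙 ((suc c ≡ᵇ a) ∧ (b ≡ᵇ d)))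
𝟙-gridAdjacentᵇ a b c d
  rewrite Boolₚ.∧-distribˡ-∨ (a ≡ᵇ c) (suc b ≡ᵇ d) (suc d ≡ᵇ b)
        | Boolₚ.∧-distribʳ-∨ (b ≡ᵇ d) (suc a ≡ᵇ c) (suc c ≡ᵇ a) =
  ≤-trans (𝟙-∨ (toRight ∨ toLeft) (toDown ∨ toUp)) (+-mono-≤ (𝟙-∨ toRight toLeft) (𝟙-∨ toDown toUp))
  where
  toRight toLeft toDown toUp : Bool
  toRight = (a ≡ᵇ c) ∧ (suc b ≡ᵇ d)
  toLeft = (a ≡ᵇ c) ∧ (suc d ≡ᵇ b)
  toDown = (suc a ≡ᵇ c) ∧ (b ≡ᵇ d)
  toUp = (suc c ≡ᵇ a) ∧ (b ≡ᵇ d)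

record GridCoordinates (G : Graph) : Set where
  field
    rows cols : ℕ
    row col : Fin (order G) → ℕ
    row<rows : ∀ v → row v < rows
    col<cols : ∀ v → col v < cols
    cell : ∀ a b → a < rows → b < cols → Fin (order G)
    row-cell : ∀ {a b} a< b< → row (cell a b a< b<) ≡ a
    col-cell : ∀ {a b} a< b< → col (cell a b a< b<) ≡ b
    coordinates-injective : ∀ u v → row u ≡ row v → col u ≡ col v → u ≡ v
    adj⇒GridAdjacent : ∀ u v → adj G u v ≡ true → GridAdjacent (row u) (col u) (row v) (col v)
    GridAdjacent⇒adj : ∀ u v → GridAdjacent (row u) (col u) (row v) (col v) → adj G u v ≡ true

transpose : ∀ {G} → GridCoordinates G → GridCoordinates G
transpose C = record
  { rows = cols ; cols = rows ; row = col ; col = row ; row<rows = col<cols ; col<cols = row<rows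
  ; cell = λ a b a< b< → cell b a b< a<
  ; row-cell = λ a< b< → col-cell b< a<
  ; col-cell = λ a< b< → row-cell b< a<
  ; coordinates-injective = λ u v col≡ row≡ → coordinates-injective u v row≡ col≡
  ; adj⇒GridAdjacent = λ u v u~v → transpose-adjacent (adj⇒GridAdjacent u v u~v)
  ; GridAdjacent⇒adj = λ u v u~v → GridAdjacent⇒adj u v (transpose-adjacent u~v) }
  where open GridCoordinates C

-- Sweeping anti-diagonals

p≢q⇒p≡q⁻¹ : ∀ {p q : Parity} → p ≢ q → p ≡ q ⁻¹
p≢q⇒p≡q⁻¹ {0ℙ} {0ℙ} p≢q = ⊥-elim (p≢q refl)
p≢q⇒p≡q⁻¹ {0ℙ} {1ℙ} _ = refl
p≢q⇒p≡q⁻¹ {1ℙ} {0ℙ} _ = refl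
p≢q⇒p≡q⁻¹ {1ℙ} {1ℙ} p≢q = ⊥-elim (p≢q refl)

parity-suc≡⁻¹ : ∀ n {p} → parity n ≡ p → parity (suc n) ≡ p ⁻¹
parity-suc≡⁻¹ n refl = trans (sym (Parityₚ.⁻¹-involutive (parity (suc n)))) (cong _⁻¹ (Parityₚ.suc-homo-⁻¹ n))

-- The first row and column of a rows × cols grid, keeping their end cells and alternating
-- with opposite phases.
SeedCell : (rows cols : ℕ) → Parity → ℕ → ℕ → Set
SeedCell rows cols p a b = (a ≡ 0 × (b ≡ 0 ⊎ parity b ≡ p ⊎ suc b ≡ cols)) ⊎ (b ≡ 0 × (parity a ≡ p ⁻¹ ⊎ suc a ≡ rows))

SeedCell-transpose : ∀ {rows cols p a b} → SeedCell cols rows (p ⁻¹) b a → SeedCell rows cols p a b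
SeedCell-transpose (inj₁ (b≡0 , inj₁ a≡0)) = inj₁ (a≡0 , inj₁ b≡0)
SeedCell-transpose (inj₁ (b≡0 , inj₂ a-seed)) = inj₂ (b≡0 , a-seed)
SeedCell-transpose {p = p} (inj₂ (a≡0 , inj₁ parity-b)) =
  inj₁ (a≡0 , inj₂ (inj₁ (trans parity-b (Parityₚ.⁻¹-involutive p))))
SeedCell-transpose (inj₂ (a≡0 , inj₂ last-b)) = inj₁ (a≡0 , inj₂ (inj₂ last-b))

module AntiDiagonalSweep (G : Graph) (adj-sym : Symmetric G) (C : GridCoordinates G) (S : Subset (order G)) where
  open Spreading G adj-sym
  open GridCoordinates C

  Reachable : Subset (order G) → Set
  Reachable = Star SpreadStep S

  below : ℕ → V → Bool
  below s v = lookup S v ∨ (row v + col v <ᵇ s)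

  wave : ℕ → ℕ → V → Bool
  wave s k v = below s v ∨ ((row v + col v ≡ᵇ s) ∧ (row v <ᵇ k))

  Below : ℕ → Subset (order G)
  Below s = tabulate (below s)

  Wave : ℕ → ℕ → Subset (order G)
  Wave s k = tabulate (wave s k)

  lookup-Wave : ∀ s k v → lookup (Wave s k) v ≡ wave s k v
  lookup-Wave s k v = Vecₚ.lookup∘tabulate (wave s k) v

  S⊆Wave : ∀ s k {v} → lookup S v ≡ true → lookup (Wave s k) v ≡ true
  S⊆Wave s k {v} v∈S rewrite lookup-Wave s k v | v∈S = refl

  below⊆Wave : ∀ {s} k {v} → row v + col v < s → lookup (Wave s k) v ≡ true
  below⊆Wave {s} k {v} v<s rewrite lookup-Wave s k v | <⇒<ᵇ≡true v<s | Boolₚ.∨-zeroʳ (lookup S v) = refl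

  diagonal⊆Wave : ∀ {s k v} → row v + col v ≡ s → row v < k → lookup (Wave s k) v ≡ true
  diagonal⊆Wave {s} {k} {v} v≡s row<k
    rewrite lookup-Wave s k v | ≡⇒≡ᵇ≡true _ _ v≡s | <⇒<ᵇ≡true row<k = Boolₚ.∨-zeroʳ _

  Wave-start : ∀ s → Wave s 0 ≡ Below s
  Wave-start s = Vecₚ.tabulate-cong λ v → trans (cong (below s v ∨_) (Boolₚ.∧-zeroʳ _)) (Boolₚ.∨-identityʳ _)

  Wave-end : ∀ s → Wave s (suc s) ≡ Below (suc s)
  Wave-end s = Vecₚ.tabulate-cong wave≡below
    where
    wave≡below : ∀ v → wave s (suc s) v ≡ below (suc s) v
    wave≡below v with <-cmp (row v + col v) s
    ... | tri< v<s _ _ rewrite <⇒<ᵇ≡true v<s | <⇒<ᵇ≡true (m<n⇒m<1+n v<s) | Boolₚ.∨-zeroʳ (lookup S v) = refl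
    ... | tri≈ _ v≡s _ rewrite <⇒<ᵇ≡true (≤-reflexive (cong suc v≡s)) | Boolₚ.∨-zeroʳ (lookup S v)
                             | ≡⇒≡ᵇ≡true _ _ v≡s | <⇒<ᵇ≡true (s≤s (≤-trans (m≤m+n (row v) (col v)) (≤-reflexive v≡s)))
                             = Boolₚ.∨-zeroʳ _
    ... | tri> _ v≢s v>s rewrite ≮⇒<ᵇ≡false (<⇒≯ v>s) | ≮⇒<ᵇ≡false (λ v<1+s → <⇒≱ v>s (s≤s⁻¹ v<1+s))
                             | ≢⇒≡ᵇ≡false _ _ v≢s = Boolₚ.∨-identityʳ _

  wave-suc-elsewhere : ∀ s k v → ¬ (row v ≡ k × row v + col v ≡ s) → wave s (suc k) v ≡ wave s k v
  wave-suc-elsewhere s k v not-kth with row v + col v ≟ s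
  ... | no v≢s rewrite ≢⇒≡ᵇ≡false _ _ v≢s = refl
  ... | yes v≡s rewrite ≡⇒≡ᵇ≡true _ _ v≡s with <-cmp (row v) k
  ...   | tri< row<k _ _ rewrite <⇒<ᵇ≡true row<k | <⇒<ᵇ≡true (m<n⇒m<1+n row<k) = refl
  ...   | tri≈ _ row≡k _ = ⊥-elim (not-kth (row≡k , v≡s))
  ...   | tri> _ _ row>k
    rewrite ≮⇒<ᵇ≡false (<⇒≯ row>k) | ≮⇒<ᵇ≡false (λ row<1+k → <⇒≱ row>k (s≤s⁻¹ row<1+k)) = refl

  adjacent-at : ∀ {u v a b c d} → row u ≡ a → col u ≡ b → row v ≡ c → col v ≡ d →
                GridAdjacent a b c d → A u v ≡ true
  adjacent-at {u} {v} refl refl refl refl = GridAdjacent⇒adj u v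

  neighbour-at : ∀ {u z a b} → row u ≡ a → col u ≡ b → A u z ≡ true → GridAdjacent a b (row z) (col z)
  neighbour-at {u} {z} refl refl u~z = adj⇒GridAdjacent u z u~z

  below-at : ∀ {s} k {v a b} → row v ≡ a → col v ≡ b → a + b < s → lookup (Wave s k) v ≡ true
  below-at k refl refl = below⊆Wave k

  diagonal-at : ∀ {s k v a b} → row v ≡ a → col v ≡ b → a + b ≡ s → a < k → lookup (Wave s k) v ≡ true
  diagonal-at refl refl = diagonal⊆Wave

  -- What anti-diagonal s needs from S to be swept from the top.
  record Seeded (s : ℕ) : Set where
    field
      top : ∀ v → row v ≡ 0 → col v ≡ s → lookup S v ≡ true
      bottom : ∀ v → row v ≡ s → col v ≡ 0 → 0 < s →
               lookup S v ≡ true ⊎ Σ[ y ∈ V ] row y ≡ suc s × col y ≡ 0 × lookup S y ≡ true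

  Seeded-of-parity : ∀ p → (∀ v → SeedCell rows cols p (row v) (col v) → lookup S v ≡ true) →
                     ∀ s → parity s ≡ p → Seeded s
  Seeded-of-parity p seed⊆S s parity≡p = record { top = top ; bottom = bottom }
    where
    top : ∀ v → row v ≡ 0 → col v ≡ s → lookup S v ≡ true
    top v row≡ col≡ = seed⊆S v (inj₁ (row≡ , inj₂ (inj₁ (trans (cong parity col≡) parity≡p))))
    bottom : ∀ v → row v ≡ s → col v ≡ 0 → 0 < s →
             lookup S v ≡ true ⊎ Σ[ y ∈ V ] row y ≡ suc s × col y ≡ 0 × lookup S y ≡ true
    bottom v row≡ col≡ _ with suc s <? rows
    ... | no 1+s≮rows = inj₁ (seed⊆S v (inj₂ (col≡ , inj₂ (≤-antisym (row<rows v)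
                           (subst (rows ≤_) (cong suc (sym row≡)) (≮⇒≥ 1+s≮rows))))))
    ... | yes 1+s<rows = inj₂ (cell (suc s) 0 1+s<rows 0<cols , row-cell 1+s<rows 0<cols , col-cell 1+s<rows 0<cols ,
      seed⊆S _ (inj₂ (col-cell 1+s<rows 0<cols ,
        inj₁ (trans (cong parity (row-cell 1+s<rows 0<cols)) (parity-suc≡⁻¹ s parity≡p)))))
      where
      0<cols : 0 < cols
      0<cols = subst (_< cols) col≡ (col<cols v)

  -- A cell off the first column is forced by its upper neighbour.
  forcing-interior : ∀ {s k j w} → row w ≡ suc k → col w ≡ suc j → suc k + suc j ≡ s →
                     Forcing (Wave s (suc k)) w
  forcing-interior {s} {k} {j} {w} row-w col-w on-s = record
    { x = x ; y = y
    ; x≢y = λ x≡y → 1+n≢n (trans (sym row-y) (trans (cong row (sym x≡y)) row-x))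
    ; w~x = adjacent-at row-w col-w row-x col-x (up refl refl)
    ; w~y = adjacent-at row-w col-w row-y col-y (left refl refl)
    ; x∈B = below-at (suc k) row-x col-x (≤-reflexive on-s)
    ; y∈B = below-at (suc k) row-y col-y (≤-reflexive (trans (sym (+-suc (suc k) j)) on-s))
    ; x-surrounded = λ z x~z z≢w → surrounded z (neighbour-at row-x col-x x~z) z≢w }
    where
    1+k<rows : suc k < rows
    1+k<rows = subst (_< rows) row-w (row<rows w)
    1+j<cols : suc j < cols
    1+j<cols = subst (_< cols) col-w (col<cols w)
    k<rows : k < rows
    k<rows = <-trans (n<1+n k) 1+k<rows
    j<cols : j < cols
    j<cols = <-trans (n<1+n j) 1+j<cols
    x y : V
    x = cell k (suc j) k<rows 1+j<cols
    y = cell (suc k) j 1+k<rows j<cols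
    row-x : row x ≡ k
    row-x = row-cell k<rows 1+j<cols
    col-x : col x ≡ suc j
    col-x = col-cell k<rows 1+j<cols
    row-y : row y ≡ suc k
    row-y = row-cell 1+k<rows j<cols
    col-y : col y ≡ j
    col-y = col-cell 1+k<rows j<cols
    surrounded : ∀ z → GridAdjacent k (suc j) (row z) (col z) → z ≢ w → lookup (Wave s (suc k)) z ≡ true
    surrounded z (right k≡ 2+j≡) _ =
      diagonal-at (sym k≡) (sym 2+j≡) (trans (+-suc k (suc j)) on-s) (n<1+n k)
    surrounded z (left k≡ 1+col≡) _ =
      below-at (suc k) (sym k≡) (suc-injective 1+col≡)
        (<-trans (n<1+n (k + j)) (≤-reflexive (trans (cong suc (sym (+-suc k j))) on-s)))
    surrounded z (down 1+k≡ j≡) z≢w =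
      ⊥-elim (z≢w (coordinates-injective z w (trans (sym 1+k≡) (sym row-w)) (trans (sym j≡) (sym col-w))))
    surrounded z (up 1+row≡ j≡) _ =
      below-at (suc k) refl (sym j≡) (<-trans (+-monoˡ-< (suc j) (≤-reflexive 1+row≡)) (≤-reflexive on-s))

  -- The bottom cell is forced by its upper neighbour too, given the blue cell y below it.
  forcing-first-column : ∀ {k w y} → row w ≡ suc k → col w ≡ 0 →
                         row y ≡ suc (suc k) → col y ≡ 0 → lookup S y ≡ true →
                         Forcing (Wave (suc k) (suc k)) w
  forcing-first-column {k} {w} {y} row-w col-w row-y col-y y∈S = record
    { x = x ; y = y
    ; x≢y = λ x≡y → <⇒≢ (m<n⇒m<1+n (n<1+n k)) (trans (sym row-x) (trans (cong row x≡y) row-y))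
    ; w~x = adjacent-at row-w col-w row-x col-x (up refl refl)
    ; w~y = adjacent-at row-w col-w row-y col-y (down refl refl)
    ; x∈B = below-at (suc k) row-x col-x (≤-reflexive (cong suc (+-identityʳ k)))
    ; y∈B = S⊆Wave (suc k) (suc k) y∈S
    ; x-surrounded = λ z x~z z≢w → surrounded z (neighbour-at row-x col-x x~z) z≢w }
    where
    k<rows : k < rows
    k<rows = <-trans (n<1+n k) (subst (_< rows) row-w (row<rows w))
    0<cols : 0 < cols
    0<cols = subst (_< cols) col-w (col<cols w)
    x : V
    x = cell k 0 k<rows 0<cols
    row-x : row x ≡ k
    row-x = row-cell k<rows 0<cols
    col-x : col x ≡ 0
    col-x = col-cell k<rows 0<cols
    surrounded : ∀ z → GridAdjacent k 0 (row z) (col z) → z ≢ w → lookup (Wave (suc k) (suc k)) z ≡ true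
    surrounded z (right k≡ 1≡) _ = diagonal-at (sym k≡) (sym 1≡) (+-comm k 1) (n<1+n k)
    surrounded z (down 1+k≡ 0≡) z≢w =
      ⊥-elim (z≢w (coordinates-injective z w (trans (sym 1+k≡) (sym row-w)) (trans (sym 0≡) (sym col-w))))
    surrounded z (up 1+row≡ 0≡) _ =
      below-at (suc k) refl (sym 0≡)
        (≤-trans (≤-reflexive (cong suc (+-identityʳ (row z)))) (m≤n⇒m≤1+n (≤-reflexive 1+row≡)))

  forcing-on-diagonal : ∀ {s k j w} → Seeded s → k + j ≡ s → row w ≡ k → col w ≡ j →
                        lookup (Wave s k) w ≡ false → Forcing (Wave s k) w
  forcing-on-diagonal {s} {zero} {j} {w} seeded on-s row-w col-w w∉B =
    ⊥-elim (true≢false (trans (sym (S⊆Wave s 0 (Seeded.top seeded w row-w (trans col-w on-s)))) w∉B))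
  forcing-on-diagonal {k = suc k} {suc j} _ on-s row-w col-w _ = forcing-interior row-w col-w on-s
  forcing-on-diagonal {s} {suc k} {zero} {w} seeded on-s row-w col-w w∉B
    with trans (sym (+-identityʳ (suc k))) on-s
  ... | refl with Seeded.bottom seeded w row-w col-w (s≤s z≤n)
  ...   | inj₁ w∈S = ⊥-elim (true≢false (trans (sym (S⊆Wave s (suc k) w∈S)) w∉B))
  ...   | inj₂ (y , row-y , col-y , y∈S) = forcing-first-column row-w col-w row-y col-y y∈S

  col-on-diagonal : ∀ {s k j} v → k + j ≡ s → row v ≡ k → row v + col v ≡ s → col v ≡ j
  col-on-diagonal {k = k} v on-s refl v-on-s = +-cancelˡ-≡ k (col v) _ (trans v-on-s (sym on-s))

  Wave-suc-empty : ∀ {s} k → (∀ v → row v ≡ k → ¬ row v + col v ≡ s) → Wave s (suc k) ≡ Wave s k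
  Wave-suc-empty {s} k no-cell =
    Vecₚ.tabulate-cong λ v → wave-suc-elsewhere s k v λ (row≡k , v-on-s) → no-cell v row≡k v-on-s

  Wave-suc-cell : ∀ {s k j} → k + j ≡ s → (k< : k < rows) (j< : j < cols) →
                  Wave s (suc k) ≡ Wave s k ∪ ⁅ cell k j k< j< ⁆
  Wave-suc-cell {s} {k} {j} on-s k< j< = ≗⇒≡ λ v →
    trans (lookup-Wave s (suc k) v) (trans (add-w v) (sym (lookup-∪ (Wave s k) ⁅ w ⁆ v)))
    where
    w : Fin (order G)
    w = cell k j k< j<
    add-w : ∀ v → wave s (suc k) v ≡ lookup (Wave s k) v ∨ lookup ⁅ w ⁆ v
    add-w v with v Finₚ.≟ w
    ... | yes refl rewrite lookup-⁅i⁆-i w | Boolₚ.∨-zeroʳ (lookup (Wave s k) w) =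
      trans (sym (lookup-Wave s (suc k) w)) (diagonal-at (row-cell k< j<) (col-cell k< j<) on-s (n<1+n k))
    ... | no v≢w rewrite lookup-⁅i⁆-j v≢w | Boolₚ.∨-identityʳ (lookup (Wave s k) v) =
      trans (wave-suc-elsewhere s k v not-at-w) (sym (lookup-Wave s k v))
      where
      not-at-w : ¬ (row v ≡ k × row v + col v ≡ s)
      not-at-w (row≡k , v-on-s) = v≢w (coordinates-injective v w (trans row≡k (sym (row-cell k< j<)))
                                          (trans (col-on-diagonal v on-s row≡k v-on-s) (sym (col-cell k< j<))))

  wave-step : ∀ {s} k j → Seeded s → k + j ≡ s → Reachable (Wave s k) → Reachable (Wave s (suc k))
  wave-step {s} k j seeded on-s reach with k <? rows | j <? cols
  ... | yes k< | yes j< = subst Reachable (sym (Wave-suc-cell on-s k< j<))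
    (spread-to (cell k j k< j<) reach (forcing-on-diagonal seeded on-s (row-cell k< j<) (col-cell k< j<)))
  ... | no k≮ | _ = subst Reachable (sym (Wave-suc-empty k λ v row≡k _ → k≮ (subst (_< rows) row≡k (row<rows v)))) reach
  ... | yes _ | no j≮ = subst Reachable (sym (Wave-suc-empty k λ v row≡k v-on-s →
    j≮ (subst (_< cols) (col-on-diagonal v on-s row≡k v-on-s) (col<cols v)))) reach

  below-step : ∀ s → Seeded s → Reachable (Below s) → Reachable (Below (suc s))
  below-step s seeded reach = subst Reachable (Wave-end s) (sweep-diagonal s 0 refl (subst Reachable (sym (Wave-start s)) reach))
    where
    sweep-diagonal : ∀ j k → k + j ≡ s → Reachable (Wave s k) → Reachable (Wave s (suc s))
    sweep-diagonal zero k on-s reach =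
      subst (λ k → Reachable (Wave s (suc k))) (trans (sym (+-identityʳ k)) on-s) (wave-step k 0 seeded on-s reach)
    sweep-diagonal (suc j) k on-s reach =
      sweep-diagonal j (suc k) (trans (sym (+-suc k j)) on-s) (wave-step k (suc j) seeded on-s reach)

module _ (G : Graph) (adj-sym : Symmetric G) (C : GridCoordinates G) (S : Subset (order G)) where
  private
    module D = AntiDiagonalSweep G adj-sym C S
    module Dᵀ = AntiDiagonalSweep G adj-sym (transpose C) S
  open GridCoordinates C

  -- Each anti-diagonal may be swept along rows or along columns.
  spreading-if-seeded : (∀ s → D.Seeded s ⊎ Dᵀ.Seeded s) → IsSpreadingSet G 2 (fin 1) S
  spreading-if-seeded seeded = subst D.Reachable Below-all≡⊤ (sweep (rows + cols))
    where
    Belowᵀ≡Below : ∀ s → Dᵀ.Below s ≡ D.Below s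
    Belowᵀ≡Below s = Vecₚ.tabulate-cong λ v → cong (λ t → lookup S v ∨ (t <ᵇ s)) (+-comm (col v) (row v))
    sweep : ∀ s → D.Reachable (D.Below s)
    sweep zero = subst D.Reachable Below-0≡S ε
      where
      Below-0≡S : S ≡ D.Below 0
      Below-0≡S = sym (trans (Vecₚ.tabulate-cong (λ v → Boolₚ.∨-identityʳ (lookup S v))) (Vecₚ.tabulate∘lookup S))
    sweep (suc s) with seeded s
    ... | inj₁ seeded-s = D.below-step s seeded-s (sweep s)
    ... | inj₂ seededᵀ-s = subst D.Reachable (Belowᵀ≡Below (suc s))
                             (Dᵀ.below-step s seededᵀ-s (subst D.Reachable (sym (Belowᵀ≡Below s)) (sweep s)))
    Below-all≡⊤ : D.Below (rows + cols) ≡ ⊤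
    Below-all≡⊤ = ≗⇒≡ λ v → trans (Vecₚ.lookup∘tabulate _ v)
      (trans (cong (lookup S v ∨_) (<⇒<ᵇ≡true (+-mono-< (row<rows v) (col<cols v))))
             (trans (Boolₚ.∨-zeroʳ _) (sym (lookup-⊤ v))))

  parity-seeded : ∀ p → (∀ v → SeedCell rows cols p (row v) (col v) → lookup S v ≡ true) →
                  ∀ s → D.Seeded s ⊎ Dᵀ.Seeded s
  parity-seeded p seed⊆S s with parity s Parityₚ.≟ p
  ... | yes parity≡p = inj₁ (D.Seeded-of-parity p seed⊆S s parity≡p)
  ... | no parity≢p =
    inj₂ (Dᵀ.Seeded-of-parity (p ⁻¹) (λ v → seed⊆S v ∘ SeedCell-transpose) s (p≢q⇒p≡q⁻¹ parity≢p))

module ColumnNeighbour {G : Graph} (C : GridCoordinates G) where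
  open GridCoordinates C

  neighbour-in-column : 2 ≤ rows → ∀ u → Σ[ x ∈ Fin (order G) ] adj G u x ≡ true × col x ≡ col u
  neighbour-in-column 2≤rows u with suc (row u) <? rows
  ... | yes 1+row< = cell _ _ 1+row< (col<cols u) ,
    GridAdjacent⇒adj u _ (down (sym (row-cell 1+row< (col<cols u))) (sym (col-cell 1+row< (col<cols u)))) ,
    col-cell 1+row< (col<cols u)
  ... | no 1+row≮ with row u in row≡ | row<rows u
  ...   | zero | _ = ⊥-elim (1+row≮ 2≤rows)
  ...   | suc r | 1+r<rows = cell r _ r<rows (col<cols u) ,
    GridAdjacent⇒adj u _ (up (trans (cong suc (row-cell r<rows (col<cols u))) (sym row≡)) (sym (col-cell r<rows (col<cols u)))) ,
    col-cell r<rows (col<cols u)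
    where r<rows = <-trans (n<1+n r) 1+r<rows

module _ {G : Graph} (C : GridCoordinates G) where
  open GridCoordinates C
  open ColumnNeighbour

  adj⇒≢ : ∀ {u x} → adj G u x ≡ true → x ≢ u
  adj⇒≢ {u} u~x refl = GridAdjacent-irrefl (adj⇒GridAdjacent u u u~x)

  grid-minDegree≥2 : 2 ≤ rows → 2 ≤ cols → MinDegree≥2 G
  grid-minDegree≥2 2≤rows 2≤cols u w with neighbour-in-column C 2≤rows u | neighbour-in-column (transpose C) 2≤cols u
  ... | xᵥ , u~xᵥ , colᵥ≡ | xₕ , u~xₕ , rowₕ≡ with xᵥ Finₚ.≟ w
  ...   | no xᵥ≢w = xᵥ , u~xᵥ , xᵥ≢w , adj⇒≢ u~xᵥ
  ...   | yes refl = xₕ , u~xₕ , xₕ≢xᵥ , adj⇒≢ u~xₕ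
    where
    xₕ≢xᵥ : xₕ ≢ xᵥ
    xₕ≢xᵥ xₕ≡xᵥ = adj⇒≢ u~xₕ (coordinates-injective xₕ u rowₕ≡ (trans (cong col xₕ≡xᵥ) colᵥ≡))

-- The grid P m □ P n

sum-𝟙-first : ∀ k → 1 ≤ k → sum {k} (λ j → 𝟙 (toℕ j ≡ᵇ 0)) ≡ 1
sum-𝟙-first (suc k) _ = cong suc (sum-zero {k} λ j → refl)

sum-𝟙-last : ∀ k → 1 ≤ k → sum {k} (λ j → 𝟙 (suc (toℕ j) ≡ᵇ k)) ≡ 1
sum-𝟙-last (suc k) _ =
  trans (sum-single _ (Fin.fromℕ k) not-last) (cong 𝟙 (≡⇒≡ᵇ≡true _ _ (cong suc (Finₚ.toℕ-fromℕ k))))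
  where
  not-last : ∀ j → j ≢ Fin.fromℕ k → 𝟙 (suc (toℕ j) ≡ᵇ suc k) ≡ 0
  not-last j j≢k = cong 𝟙 (≢⇒≡ᵇ≡false (toℕ j) k λ j≡k →
    j≢k (Finₚ.toℕ-injective (trans j≡k (sym (Finₚ.toℕ-fromℕ k)))))

⌈x/2⌉≤y : ∀ {x y} → x ≤ y + y → ⌈ x /2⌉ ≤ y
⌈x/2⌉≤y {y = y} x≤2y = ≤-trans (⌈n/2⌉-mono x≤2y) (≤-reflexive (sym (n≡⌈n+n/2⌉ y)))

n+m+1≤mn+mn : ∀ {m n} → 2 ≤ m → 2 ≤ n → n + m + 1 ≤ m * n + m * n
n+m+1≤mn+mn {suc (suc a)} {suc (suc b)} (s≤s (s≤s _)) (s≤s (s≤s _)) = begin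
  suc (suc b) + suc (suc a) + 1                       ≤⟨ m≤m+n _ (3 + 3 * a + 3 * b + 2 * (a * b)) ⟩
  suc (suc b) + suc (suc a) + 1 + (3 + 3 * a + 3 * b + 2 * (a * b)) ≡⟨ expand a b ⟩
  suc (suc a) * suc (suc b) + suc (suc a) * suc (suc b) ∎
  where
  open ≤-Reasoning
  expand : ∀ a b → suc (suc b) + suc (suc a) + 1 + (3 + 3 * a + 3 * b + 2 * (a * b)) ≡
                   suc (suc a) * suc (suc b) + suc (suc a) * suc (suc b)
  expand = solve-∀

module GridGraph (m n : ℕ) where

  row col : Fin (m * n) → ℕ
  row v = toℕ (proj₁ (remQuot {m} n v))
  col v = toℕ (proj₂ (remQuot {m} n v))

  adj≡gridAdjacentᵇ : ∀ u v → adj (P m □ P n) u v ≡ gridAdjacentᵇ (row u) (col u) (row v) (col v)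
  adj≡gridAdjacentᵇ u v with remQuot {m} n u | remQuot {m} n v
  ... | _ | _ = refl

  □-symmetric : Symmetric (P m □ P n)
  □-symmetric u v = trans (adj≡gridAdjacentᵇ u v)
    (trans (gridAdjacentᵇ-sym (row u) (col u) (row v) (col v)) (sym (adj≡gridAdjacentᵇ v u)))

  cell : ∀ a b → a < m → b < n → Fin (m * n)
  cell a b a< b< = combine (fromℕ< a<) (fromℕ< b<)

  coordinates : GridCoordinates (P m □ P n)
  coordinates = record
    { rows = m ; cols = n ; row = row ; col = col
    ; row<rows = λ v → Finₚ.toℕ<n _ ; col<cols = λ v → Finₚ.toℕ<n _
    ; cell = cell
    ; row-cell = λ a< b< → trans (cong (toℕ ∘ proj₁) (Finₚ.remQuot-combine (fromℕ< a<) (fromℕ< b<))) (Finₚ.toℕ-fromℕ< a<)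
    ; col-cell = λ a< b< → trans (cong (toℕ ∘ proj₂) (Finₚ.remQuot-combine (fromℕ< a<) (fromℕ< b<))) (Finₚ.toℕ-fromℕ< b<)
    ; coordinates-injective = λ u v row≡ col≡ → trans (sym (Finₚ.combine-remQuot {m} n u))
        (trans (cong₂ combine (Finₚ.toℕ-injective row≡) (Finₚ.toℕ-injective col≡)) (Finₚ.combine-remQuot {m} n v))
    ; adj⇒GridAdjacent = λ u v u~v → gridAdjacentᵇ-sound _ _ _ _ (trans (sym (adj≡gridAdjacentᵇ u v)) u~v)
    ; GridAdjacent⇒adj = λ u v u~v → trans (adj≡gridAdjacentᵇ u v) (gridAdjacentᵇ-complete _ _ _ _ u~v) }

  open Spreading (P m □ P n) □-symmetric using (Φ; blueDegree; spreading-lower-bound)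

  degree : Fin (m * n) → ℕ
  degree v = sum (λ x → 𝟙 (adj (P m □ P n) v x))

  Φ⊤≡sum-degree : Φ ⊤ ≡ sum degree
  Φ⊤≡sum-degree = sum-cong-≗ λ v → begin
    𝟙 (lookup ⊤ v) * blueDegree ⊤ v ≡⟨ cong (λ b → 𝟙 b * blueDegree ⊤ v) (lookup-⊤ v) ⟩
    blueDegree ⊤ v + 0              ≡⟨ +-identityʳ _ ⟩
    blueDegree ⊤ v                  ≡⟨ sum-cong-≗ (λ x → cong (λ b → 𝟙 (adj (P m □ P n) v x ∧ b)) (lookup-⊤ x)) ⟩
    sum (λ x → 𝟙 (adj (P m □ P n) v x ∧ true)) ≡⟨ sum-cong-≗ (λ x → cong 𝟙 (Boolₚ.∧-identityʳ (adj (P m □ P n) v x))) ⟩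
    degree v                        ∎
    where open ≡-Reasoning

  occupancy : ℕ → ℕ → ℕ
  occupancy a b = sum (λ x → 𝟙 ((a ≡ᵇ row x) ∧ (b ≡ᵇ col x)))

  occupancy≤1 : ∀ a b → occupancy a b ≤ 1
  occupancy≤1 a b = sum≤1 _ (λ x → 𝟙≤1 _) unique
    where
    at-cell : ∀ {x} → 1 ≤ 𝟙 ((a ≡ᵇ row x) ∧ (b ≡ᵇ col x)) → row x ≡ a × col x ≡ b
    at-cell {x} 1≤ with a ≡ᵇ row x in a≡ | b ≡ᵇ col x in b≡
    ... | true | true = sym (≡ᵇ≡true⇒≡ a (row x) a≡) , sym (≡ᵇ≡true⇒≡ b (col x) b≡)
    unique : ∀ x y → 1 ≤ 𝟙 ((a ≡ᵇ row x) ∧ (b ≡ᵇ col x)) → 1 ≤ 𝟙 ((a ≡ᵇ row y) ∧ (b ≡ᵇ col y)) → x ≡ y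
    unique x y 1≤x 1≤y with at-cell {x} 1≤x | at-cell {y} 1≤y
    ... | row-x , col-x | row-y , col-y = GridCoordinates.coordinates-injective coordinates x y
                                             (trans row-x (sym row-y)) (trans col-x (sym col-y))

  occupancy-outside-row : ∀ a b → m ≤ a → occupancy a b ≡ 0
  occupancy-outside-row a b m≤a = sum-zero λ x →
    cong (λ t → 𝟙 (t ∧ (b ≡ᵇ col x))) (≢⇒≡ᵇ≡false a (row x) λ a≡ → <⇒≱ (Finₚ.toℕ<n _) (subst (m ≤_) a≡ m≤a))

  occupancy-outside-col : ∀ a b → n ≤ b → occupancy a b ≡ 0
  occupancy-outside-col a b n≤b = sum-zero λ x →
    trans (cong (λ t → 𝟙 ((a ≡ᵇ row x) ∧ t)) (≢⇒≡ᵇ≡false b (col x) λ b≡ → <⇒≱ (Finₚ.toℕ<n _) (subst (n ≤_) b≡ n≤b)))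
          (cong 𝟙 (Boolₚ.∧-zeroʳ _))

  occupancy+𝟙-last-col≤1 : ∀ a b → occupancy a b + 𝟙 (b ≡ᵇ n) ≤ 1
  occupancy+𝟙-last-col≤1 a b with b ≟ n
  ... | yes refl rewrite occupancy-outside-col a b ≤-refl | ≡⇒≡ᵇ≡true b b refl = ≤-refl
  ... | no b≢n rewrite ≢⇒≡ᵇ≡false b n b≢n | +-identityʳ (occupancy a b) = occupancy≤1 a b

  occupancy+𝟙-last-row≤1 : ∀ a b → occupancy a b + 𝟙 (a ≡ᵇ m) ≤ 1
  occupancy+𝟙-last-row≤1 a b with a ≟ m
  ... | yes refl rewrite occupancy-outside-row a b ≤-refl | ≡⇒≡ᵇ≡true a a refl = ≤-refl
  ... | no a≢m rewrite ≢⇒≡ᵇ≡false a m a≢m | +-identityʳ (occupancy a b) = occupancy≤1 a b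

  left-count up-count : Fin (m * n) → ℕ
  left-count v = sum (λ x → 𝟙 ((row v ≡ᵇ row x) ∧ (suc (col x) ≡ᵇ col v)))
  up-count v = sum (λ x → 𝟙 ((suc (row x) ≡ᵇ row v) ∧ (col v ≡ᵇ col x)))

  left-count+𝟙-first-col≤1 : ∀ v → left-count v + 𝟙 (col v ≡ᵇ 0) ≤ 1
  left-count+𝟙-first-col≤1 v with col v
  ... | zero rewrite sum-zero {f = λ x → 𝟙 ((row v ≡ᵇ row x) ∧ false)} (λ x → cong 𝟙 (Boolₚ.∧-zeroʳ _))
    = ≤-refl
  ... | suc c = begin
    left-count′ + 0 ≡⟨ +-identityʳ _ ⟩
    left-count′     ≡⟨ sum-cong-≗ (λ x → cong (λ t → 𝟙 ((row v ≡ᵇ row x) ∧ t)) (≡ᵇ-sym (col x) c)) ⟩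
    occupancy (row v) c ≤⟨ occupancy≤1 (row v) c ⟩
    1 ∎
    where
    open ≤-Reasoning
    left-count′ : ℕ
    left-count′ = sum (λ x → 𝟙 ((row v ≡ᵇ row x) ∧ (col x ≡ᵇ c)))

  up-count+𝟙-first-row≤1 : ∀ v → up-count v + 𝟙 (row v ≡ᵇ 0) ≤ 1
  up-count+𝟙-first-row≤1 v with row v
  ... | zero rewrite sum-zero {f = λ x → 𝟙 (false ∧ (col v ≡ᵇ col x))} (λ x → refl) = ≤-refl
  ... | suc r = begin
    up-count′ + 0   ≡⟨ +-identityʳ _ ⟩
    up-count′       ≡⟨ sum-cong-≗ (λ x → cong (λ t → 𝟙 (t ∧ (col v ≡ᵇ col x))) (≡ᵇ-sym (row x) r)) ⟩
    occupancy r (col v) ≤⟨ occupancy≤1 r (col v) ⟩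
    1 ∎
    where
    open ≤-Reasoning
    up-count′ : ℕ
    up-count′ = sum (λ x → 𝟙 ((row x ≡ᵇ r) ∧ (col v ≡ᵇ col x)))

  boundary : Fin (m * n) → ℕ
  boundary v = 𝟙 (suc (col v) ≡ᵇ n) + 𝟙 (col v ≡ᵇ 0) + (𝟙 (suc (row v) ≡ᵇ m) + 𝟙 (row v ≡ᵇ 0))

  degree+boundary≤4 : ∀ v → degree v + boundary v ≤ 4
  degree+boundary≤4 v = begin
    degree v + boundary v
      ≤⟨ +-monoˡ-≤ (boundary v) degree≤ ⟩
    R + L + (D + U) + (bR + bL + (bD + bU))
      ≡⟨ rearrange R L D U bR bL bD bU ⟩
    (R + bR) + (L + bL) + ((D + bD) + (U + bU))
      ≤⟨ +-mono-≤ (+-mono-≤ (occupancy+𝟙-last-col≤1 (row v) (suc (col v))) (left-count+𝟙-first-col≤1 v))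
                  (+-mono-≤ (occupancy+𝟙-last-row≤1 (suc (row v)) (col v)) (up-count+𝟙-first-row≤1 v)) ⟩
    4 ∎
    where
    open ≤-Reasoning
    R L D U bR bL bD bU : ℕ
    R = occupancy (row v) (suc (col v))
    L = left-count v
    D = occupancy (suc (row v)) (col v)
    U = up-count v
    bR = 𝟙 (suc (col v) ≡ᵇ n)
    bL = 𝟙 (col v ≡ᵇ 0)
    bD = 𝟙 (suc (row v) ≡ᵇ m)
    bU = 𝟙 (row v ≡ᵇ 0)
    degree≤ : degree v ≤ R + L + (D + U)
    degree≤ = begin
      degree v ≤⟨ sum-mono-≤ (λ x → subst (λ t → 𝟙 t ≤ f₁ x + f₂ x + (f₃ x + f₄ x)) (sym (adj≡gridAdjacentᵇ v x))
                                       (𝟙-gridAdjacentᵇ (row v) (col v) (row x) (col x))) ⟩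
      sum (λ x → f₁ x + f₂ x + (f₃ x + f₄ x))
        ≡⟨ trans (∑-distrib-+ (λ x → f₁ x + f₂ x) (λ x → f₃ x + f₄ x))
                 (cong₂ _+_ (∑-distrib-+ f₁ f₂) (∑-distrib-+ f₃ f₄)) ⟩
      R + L + (D + U) ∎
      where
      f₁ f₂ f₃ f₄ : Fin (m * n) → ℕ
      f₁ x = 𝟙 ((row v ≡ᵇ row x) ∧ (suc (col v) ≡ᵇ col x))
      f₂ x = 𝟙 ((row v ≡ᵇ row x) ∧ (suc (col x) ≡ᵇ col v))
      f₃ x = 𝟙 ((suc (row v) ≡ᵇ row x) ∧ (col v ≡ᵇ col x))
      f₄ x = 𝟙 ((suc (row x) ≡ᵇ row v) ∧ (col v ≡ᵇ col x))
    rearrange : ∀ a b c d e f g h → a + b + (c + d) + (e + f + (g + h)) ≡ a + e + (b + f) + (c + g + (d + h))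
    rearrange = solve-∀

  sum-over-col : ∀ (g : ℕ → ℕ) → sum (λ v → g (col v)) ≡ m * sum {n} (λ j → g (toℕ j))
  sum-over-col g = trans (sum-combine m (λ v → g (col v)))
    (trans (sum-cong-≗ λ i → sum-cong-≗ λ j → cong (g ∘ toℕ ∘ proj₂) (Finₚ.remQuot-combine {m} {n} i j))
           (sum-const {m} (sum {n} (λ j → g (toℕ j)))))

  sum-over-row : ∀ (g : ℕ → ℕ) → sum (λ v → g (row v)) ≡ n * sum {m} (λ i → g (toℕ i))
  sum-over-row g = trans (sum-combine m (λ v → g (row v)))
    (trans (sum-cong-≗ λ i → trans (sum-cong-≗ λ j → cong (g ∘ toℕ ∘ proj₁) (Finₚ.remQuot-combine {m} {n} i j))
                                    (sum-const {n} (g (toℕ i))))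
           (sym (*-distribˡ-sum {m} n (λ i → g (toℕ i)))))

  sum-boundary : 1 ≤ m → 1 ≤ n → sum boundary ≡ m * 1 + m * 1 + (n * 1 + n * 1)
  sum-boundary 1≤m 1≤n = begin
    sum boundary
      ≡⟨ trans (∑-distrib-+ (λ v → bR v + bL v) (λ v → bD v + bU v))
               (cong₂ _+_ (∑-distrib-+ bR bL) (∑-distrib-+ bD bU)) ⟩
    sum bR + sum bL + (sum bD + sum bU)
      ≡⟨ cong₂ _+_ (cong₂ _+_ (trans (sum-over-col (λ c → 𝟙 (suc c ≡ᵇ n))) (cong (m *_) (sum-𝟙-last n 1≤n)))
                              (trans (sum-over-col (λ c → 𝟙 (c ≡ᵇ 0))) (cong (m *_) (sum-𝟙-first n 1≤n))))
                   (cong₂ _+_ (trans (sum-over-row (λ r → 𝟙 (suc r ≡ᵇ m))) (cong (n *_) (sum-𝟙-last m 1≤m)))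
                              (trans (sum-over-row (λ r → 𝟙 (r ≡ᵇ 0))) (cong (n *_) (sum-𝟙-first m 1≤m)))) ⟩
    m * 1 + m * 1 + (n * 1 + n * 1) ∎
    where
    open ≡-Reasoning
    bR bL bD bU : Fin (m * n) → ℕ
    bR v = 𝟙 (suc (col v) ≡ᵇ n)
    bL v = 𝟙 (col v ≡ᵇ 0)
    bD v = 𝟙 (suc (row v) ≡ᵇ m)
    bU v = 𝟙 (row v ≡ᵇ 0)

  Φ⊤+2[m+n]≤4mn : 1 ≤ m → 1 ≤ n → Φ ⊤ + 2 * (m + n) ≤ 4 * (m * n)
  Φ⊤+2[m+n]≤4mn 1≤m 1≤n = begin
    Φ ⊤ + 2 * (m + n)                       ≡⟨ cong₂ _+_ Φ⊤≡sum-degree (arrange m n) ⟩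
    sum degree + (m * 1 + m * 1 + (n * 1 + n * 1)) ≡⟨ cong (sum degree +_) (sum-boundary 1≤m 1≤n) ⟨
    sum degree + sum boundary               ≡⟨ ∑-distrib-+ degree boundary ⟨
    sum (λ v → degree v + boundary v)       ≤⟨ sum-mono-≤ degree+boundary≤4 ⟩
    sum {m * n} (λ _ → 4)                   ≡⟨ trans (sum-const {m * n} 4) (*-comm (m * n) 4) ⟩
    4 * (m * n)                             ∎
    where
    open ≤-Reasoning
    arrange : ∀ m n → 2 * (m + n) ≡ m * 1 + m * 1 + (n * 1 + n * 1)
    arrange = solve-∀

  spreading-set-size≥ : 2 ≤ m → 2 ≤ n → ∀ S → IsSpreadingSet (P m □ P n) 2 (fin 1) S → ⌈ (n + m + 1) /2⌉ ≤ ∣ S ∣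
  spreading-set-size≥ 2≤m 2≤n S spreading
    with spreading-lower-bound (grid-minDegree≥2 coordinates 2≤m 2≤n) S spreading
  ... | inj₁ refl = ⌈x/2⌉≤y (begin
    n + m + 1           ≤⟨ n+m+1≤mn+mn 2≤m 2≤n ⟩
    m * n + m * n       ≡⟨ cong₂ _+_ (Subsetₚ.∣⊤∣≡n (m * n)) (Subsetₚ.∣⊤∣≡n (m * n)) ⟨
    ∣ S ∣ + ∣ S ∣       ∎)
    where open ≤-Reasoning
  ... | inj₂ 2+4mn≤Φ⊤+4∣S∣ = ⌈x/2⌉≤y (*-cancelˡ-≤ 2 (+-cancelˡ-≤ (4 * (m * n)) _ _ (begin
    4 * (m * n) + 2 * (n + m + 1)        ≡⟨ arrange m n ⟩
    2 + 4 * (m * n) + 2 * (m + n)        ≤⟨ +-monoˡ-≤ (2 * (m + n)) 2+4mn≤Φ⊤+4∣S∣ ⟩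
    Φ ⊤ + 4 * ∣ S ∣ + 2 * (m + n)        ≡⟨ swap (Φ ⊤) (4 * ∣ S ∣) (2 * (m + n)) ⟩
    Φ ⊤ + 2 * (m + n) + 4 * ∣ S ∣        ≤⟨ +-monoˡ-≤ (4 * ∣ S ∣) (Φ⊤+2[m+n]≤4mn (<⇒≤ 2≤m) (<⇒≤ 2≤n)) ⟩
    4 * (m * n) + 4 * ∣ S ∣              ≡⟨ cong (4 * (m * n) +_) (double ∣ S ∣) ⟩
    4 * (m * n) + 2 * (∣ S ∣ + ∣ S ∣)    ∎)))
    where
    open ≤-Reasoning
    arrange : ∀ m n → 4 * (m * n) + 2 * (n + m + 1) ≡ 2 + 4 * (m * n) + 2 * (m + n)
    arrange = solve-∀
    swap : ∀ a b c → a + b + c ≡ a + c + b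
    swap = solve-∀
    double : ∀ s → 4 * s ≡ 2 * (s + s)
    double = solve-∀

  cells : List (ℕ × ℕ) → Subset (m * n)
  cells [] = ⊥
  cells ((a , b) ∷ l) = tabulate (λ x → (a ≡ᵇ row x) ∧ (b ≡ᵇ col x)) ∪ cells l

  ∣cells∣≤length : ∀ l → ∣ cells l ∣ ≤ length l
  ∣cells∣≤length [] = ≤-reflexive (Subsetₚ.∣⊥∣≡0 (m * n))
  ∣cells∣≤length ((a , b) ∷ l) =
    ≤-trans (∣p∪q∣≤∣p∣+∣q∣ (tabulate cell-ab) (cells l)) (+-mono-≤ ∣cell-ab∣≤1 (∣cells∣≤length l))
    where
    cell-ab : Fin (m * n) → Bool
    cell-ab x = (a ≡ᵇ row x) ∧ (b ≡ᵇ col x)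
    ∣cell-ab∣≤1 : ∣ tabulate cell-ab ∣ ≤ 1
    ∣cell-ab∣≤1 = ≤-trans (≤-reflexive (trans (∣p∣≡sum (tabulate cell-ab))
                                              (sum-cong-≗ λ x → cong 𝟙 (Vecₚ.lookup∘tabulate cell-ab x))))
                          (occupancy≤1 a b)

  ∈⇒∈cells : ∀ {v} l → (row v , col v) ∈ l → lookup (cells l) v ≡ true
  ∈⇒∈cells {v} ((a , b) ∷ l) (here refl)
    rewrite lookup-∪ (tabulate (λ x → (row v ≡ᵇ row x) ∧ (col v ≡ᵇ col x))) (cells l) v
          | Vecₚ.lookup∘tabulate (λ x → (row v ≡ᵇ row x) ∧ (col v ≡ᵇ col x)) v
          | ≡⇒≡ᵇ≡true (row v) (row v) refl | ≡⇒≡ᵇ≡true (col v) (col v) refl = refl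
  ∈⇒∈cells {v} ((a , b) ∷ l) (there v∈l)
    rewrite lookup-∪ (tabulate (λ x → (a ≡ᵇ row x) ∧ (b ≡ᵇ col x))) (cells l) v | ∈⇒∈cells l v∈l = Boolₚ.∨-zeroʳ _

-- Seeds

stride : ℕ → ℕ → List ℕ
stride a zero = []
stride a (suc k) = a ∷ stride (2 + a) k

length-stride : ∀ a k → length (stride a k) ≡ k
length-stride a zero = refl
length-stride a (suc k) = cong suc (length-stride (2 + a) k)

∈-stride : ∀ {a j} k → a ≤ j → j < a + 2 * k → parity j ≡ parity a → j ∈ stride a k
∈-stride {a} {j} zero a≤j j<a+0 _ = ⊥-elim (<⇒≱ j<a+0 (≤-trans (≤-reflexive (+-identityʳ a)) a≤j))
∈-stride {a} {j} (suc k) a≤j j< same-parity with a ≟ j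
... | yes refl = here refl
... | no a≢j = there (∈-stride k 2+a≤j (≤-trans j< (≤-reflexive (shift a k))) same-parity)
  where
  1+a≢j : suc a ≢ j
  1+a≢j refl = Parityₚ.p≢p⁻¹ (parity a) (trans (sym same-parity) (parity-suc≡⁻¹ a refl))
  2+a≤j : 2 + a ≤ j
  2+a≤j = ≤∧≢⇒< (≤∧≢⇒< a≤j a≢j) 1+a≢j
  shift : ∀ a k → a + 2 * suc k ≡ 2 + a + 2 * k
  shift = solve-∀

n≤2*⌈n/2⌉ : ∀ n → n ≤ 2 * ⌈ n /2⌉
n≤2*⌈n/2⌉ n = begin
  n                         ≡⟨ ⌊n/2⌋+⌈n/2⌉≡n n ⟨
  ⌊ n /2⌋ + ⌈ n /2⌉         ≤⟨ +-monoˡ-≤ ⌈ n /2⌉ (⌊n/2⌋≤⌈n/2⌉ n) ⟩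
  ⌈ n /2⌉ + ⌈ n /2⌉         ≡⟨ cong (⌈ n /2⌉ +_) (+-identityʳ ⌈ n /2⌉) ⟨
  2 * ⌈ n /2⌉               ∎
  where open ≤-Reasoning

n<2+2*⌊n/2⌋ : ∀ n → n < 2 + 2 * ⌊ n /2⌋
n<2+2*⌊n/2⌋ zero = s≤s z≤n
n<2+2*⌊n/2⌋ (suc zero) = s≤s (s≤s z≤n)
n<2+2*⌊n/2⌋ (suc (suc n)) = ≤-trans (s≤s (s≤s (n<2+2*⌊n/2⌋ n))) (≤-reflexive (two-more ⌊ n /2⌋))
  where
  two-more : ∀ h → 2 + (2 + 2 * h) ≡ 2 + 2 * suc h
  two-more = solve-∀

-- The numbers 1 ≤ j ≤ t of parity q.
ofParity : Parity → ℕ → List ℕ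
ofParity 0ℙ t = stride 2 ⌊ t /2⌋
ofParity 1ℙ t = stride 1 ⌈ t /2⌉

∈-ofParity : ∀ q {t j} → 1 ≤ j → j ≤ t → parity j ≡ q → j ∈ ofParity q t
∈-ofParity 0ℙ {t} {j} 1≤j j≤t parity-j = ∈-stride ⌊ t /2⌋ 2≤j (≤-trans (s≤s j≤t) (n<2+2*⌊n/2⌋ t)) parity-j
  where
  2≤j : 2 ≤ j
  2≤j = ≤∧≢⇒< 1≤j λ { refl → 1ℙ≢0ℙ parity-j }
    where 1ℙ≢0ℙ : 1ℙ ≢ 0ℙ
          1ℙ≢0ℙ ()
∈-ofParity 1ℙ {t} {j} 1≤j j≤t parity-j = ∈-stride ⌈ t /2⌉ 1≤j (s≤s (≤-trans j≤t (n≤2*⌈n/2⌉ t))) parity-j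

⌊x/2⌋+⌈y/2⌉ : ∀ x y → parity x ≡ 1ℙ → ⌊ x /2⌋ + ⌈ y /2⌉ ≡ ⌊ (x + y) /2⌋
⌊x/2⌋+⌈y/2⌉ (suc zero) y _ = refl
⌊x/2⌋+⌈y/2⌉ (suc (suc x)) y odd = cong suc (⌊x/2⌋+⌈y/2⌉ x y odd)

⌈x/2⌉+⌊y/2⌋ : ∀ x y → parity x ≡ 0ℙ → ⌈ x /2⌉ + ⌊ y /2⌋ ≡ ⌊ (x + y) /2⌋
⌈x/2⌉+⌊y/2⌋ zero y _ = refl
⌈x/2⌉+⌊y/2⌋ (suc (suc x)) y even = cong suc (⌈x/2⌉+⌊y/2⌋ x y even)

-- The phase p = (parity x)⁻¹ makes the two alternating segments of lengths x and y fit in ⌊(x + y)/2⌋ cells.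
length-ofParity-pair : ∀ x y →
  length (ofParity ((parity x) ⁻¹) x) + length (ofParity ((parity x) ⁻¹ ⁻¹) y) ≡ ⌊ (x + y) /2⌋
length-ofParity-pair x y with parity x in parity-x
... | 0ℙ = trans (cong₂ _+_ (length-stride 1 ⌈ x /2⌉) (length-stride 2 ⌊ y /2⌋)) (⌈x/2⌉+⌊y/2⌋ x y parity-x)
... | 1ℙ = trans (cong₂ _+_ (length-stride 2 ⌊ x /2⌋) (length-stride 1 ⌈ y /2⌉)) (⌊x/2⌋+⌈y/2⌉ x y parity-x)

first⊎last⊎interior : ∀ {b x} → b < suc (suc x) → b ≡ 0 ⊎ b ≡ suc x ⊎ (1 ≤ b × b ≤ x)
first⊎last⊎interior {zero} _ = inj₁ refl
first⊎last⊎interior {suc b} {x} (s≤s b<1+x) with suc b ≟ suc x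
... | yes b≡x = inj₂ (inj₁ b≡x)
... | no b≢x = inj₂ (inj₂ (s≤s z≤n , s≤s⁻¹ (≤∧≢⇒< b<1+x b≢x)))

module GridSeeds (x y : ℕ) where
  m n : ℕ
  m = suc (suc y)
  n = suc (suc x)

  open GridGraph m n

  k : ℕ
  k = ⌈ (n + m + 1) /2⌉

  p : Parity
  p = (parity x) ⁻¹

  inFirstRow inFirstCol : ℕ → ℕ × ℕ
  inFirstRow j = (0 , j)
  inFirstCol i = (i , 0)

  seeds : List (ℕ × ℕ)
  seeds = (0 , 0) ∷ (0 , suc x) ∷ (suc y , 0) ∷ (map inFirstRow (ofParity p x) ++ map inFirstCol (ofParity (p ⁻¹) y))

  length-seeds : length seeds ≡ k
  length-seeds = begin
    3 + length (map inFirstRow (ofParity p x) ++ map inFirstCol (ofParity (p ⁻¹) y))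
      ≡⟨ cong (3 +_) (trans (Listₚ.length-++ (map inFirstRow (ofParity p x)) {map inFirstCol (ofParity (p ⁻¹) y)})
                            (cong₂ _+_ (Listₚ.length-map inFirstRow (ofParity p x))
                                       (Listₚ.length-map inFirstCol (ofParity (p ⁻¹) y)))) ⟩
    3 + (length (ofParity p x) + length (ofParity (p ⁻¹) y))
      ≡⟨ cong (3 +_) (length-ofParity-pair x y) ⟩
    3 + ⌊ (x + y) /2⌋
      ≡⟨ cong ⌊_/2⌋ (arrange x y) ⟩
    ⌊ suc (suc (suc x) + suc (suc y) + 1) /2⌋ ∎
    where
    open ≡-Reasoning
    arrange : ∀ x y → 6 + (x + y) ≡ suc (suc (suc x) + suc (suc y) + 1)
    arrange = solve-∀

  SeedCell⇒∈seeds : ∀ {a b} → a < m → b < n → SeedCell m n p a b → (a , b) ∈ seeds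
  SeedCell⇒∈seeds _ _ (inj₁ (refl , inj₁ refl)) = here refl
  SeedCell⇒∈seeds _ _ (inj₁ (refl , inj₂ (inj₂ refl))) = there (here refl)
  SeedCell⇒∈seeds {b = b} _ b< (inj₁ (refl , inj₂ (inj₁ parity-b))) with first⊎last⊎interior b<
  ... | inj₁ refl = here refl
  ... | inj₂ (inj₁ refl) = there (here refl)
  ... | inj₂ (inj₂ (1≤b , b≤x)) =
          there (there (there (∈-++⁺ˡ (∈-map⁺ inFirstRow (∈-ofParity p 1≤b b≤x parity-b)))))
  SeedCell⇒∈seeds _ _ (inj₂ (refl , inj₂ refl)) = there (there (here refl))
  SeedCell⇒∈seeds {a = a} a< _ (inj₂ (refl , inj₁ parity-a)) with first⊎last⊎interior a<
  ... | inj₁ refl = here refl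
  ... | inj₂ (inj₁ refl) = there (there (here refl))
  ... | inj₂ (inj₂ (1≤a , a≤y)) = there (there (there
          (∈-++⁺ʳ (map inFirstRow (ofParity p x)) (∈-map⁺ inFirstCol (∈-ofParity (p ⁻¹) 1≤a a≤y parity-a)))))

  spreading-set-of-size : Σ[ S ∈ Subset (m * n) ] IsSpreadingSet (P m □ P n) 2 (fin 1) S × ∣ S ∣ ≡ k
  spreading-set-of-size = spreading-superset (⊇-of-size (cells seeds) k
    (≤-trans (∣cells∣≤length seeds) (≤-reflexive length-seeds))
    (⌈x/2⌉≤y (n+m+1≤mn+mn {m} {n} (s≤s (s≤s z≤n)) (s≤s (s≤s z≤n)))))
    where
    spreading-superset : Σ[ S ∈ Subset (m * n) ] (∀ v → lookup (cells seeds) v ≡ true → lookup S v ≡ true) × ∣ S ∣ ≡ k →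
                         Σ[ S ∈ Subset (m * n) ] IsSpreadingSet (P m □ P n) 2 (fin 1) S × ∣ S ∣ ≡ k
    spreading-superset (S , seeds⊆S , ∣S∣≡k) = S , spreading-if-seeded (P m □ P n) □-symmetric coordinates S
      (parity-seeded (P m □ P n) □-symmetric coordinates S p λ v seed →
        seeds⊆S v (∈⇒∈cells seeds (SeedCell⇒∈seeds (Finₚ.toℕ<n _) (Finₚ.toℕ<n _) seed))) , ∣S∣≡k

σ-grid : ∀ m n → 2 ≤ m → 2 ≤ n → σ≡ (P m □ P n) 2 (fin 1) ⌈ (n + m + 1) /2⌉
σ-grid (suc (suc y)) (suc (suc x)) 2≤m@(s≤s (s≤s _)) 2≤n@(s≤s (s≤s _)) =
  GridSeeds.spreading-set-of-size x y , GridGraph.spreading-set-size≥ _ _ 2≤m 2≤n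

theorem5p2 : (m n : ℕ) → m ≥ 3 → n ≥ 3 →
    σ≡ (P m □ P n) 2 (fin 1) ⌈ (n + m + 1) /2⌉
theorem5p2 m n 3≤m 3≤n = σ-grid m n (≤-trans (n≤1+n 2) 3≤m) (≤-trans (n≤1+n 2) 3≤n)
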